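{- Let $n\geqslant2$, $q$ a prime power, $c\in C_{n-1}(n,q)$, and let $\pi$ be a plane of $\mathrm{PG}(n,q)$ of type $\mathcal{T}$. Then every line of $\pi$ is either a short or a long secant to $\mathrm{supp}(c)$. If the type of $\pi$ is one of $T_0,T_{q+1},T_{2q},T_{2q+1}$, then every line of $\pi$ meets $\mathrm{supp}(c)$ in at most $2$ or in at least $q$ points.
   Context: $q=p^h$, $p$ prime. $C_{n-1}(n,q)$ is the $\mathbb{F}_p$-span of the incidence (characteristic) vectors of the hyperplanes of $\mathrm{PG}(n,q)$, inside the space of functions from points to $\mathbb{F}_p$; subspaces are identified with their incidence vectors. $\mathrm{supp}(c)=\{P:c(P)\neq0\}$, $\mathrm{wt}(c)=|\mathrm{supp}(c)|$. A line meeting $\mathrm{supp}(c)$ in exactly $\alpha$ points is an $\alpha$-secant; short if $\alpha\leqslant3$, long if $\alpha\geqslant q-1$. For a plane $\pi$, $c|_\pi$ (restriction to $\pi$) is a code word of $C_1(2,q)$. The plane $\pi$ is of type $T_w$ if $c|_\pi$ is an $\mathbb{F}_p$-linear combination of at most two lines, with $w=\mathrm{wt}(c|_\pi)$; type $T^{\triangle}$ if it is a linear combination of three non-concurrent lines; type $T^{\star}$ if a linear combination of three concurrent lines; type $T^{\mathrm{odd}}$ if $q=p$ is an odd prime and, identifying $\pi$ with $\mathrm{PG}(2,p)$ with coordinates $(X_0,X_1,X_2)$, $c|_\pi=(\gamma c_0+\lambda m+\lambda' m'+\lambda'' m'')^\sigma$ for a collineation $\sigma$, $\gamma\neq0$,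 $\lambda,\lambda',\lambda''\in\mathbb{F}_p$, where $m:X_0=0$, $m':X_1=0$, $m'':X_0=X_1$, $c_0(0,1,a)=a$, $c_0(1,0,b)=b$, $c_0(1,1,e)=-e$ and $c_0=0$ elsewhere. $\pi$ is of type $\mathcal{T}$ if it is of one of the types in $\mathcal{T}=\{T_0,T_{q+1},T_{2q},T_{2q+1},T^{\mathrm{odd}},T^{\triangle},T^{\star}\}$. -}

module Defs where

open import Level using (0ℓ)
open import Data.Nat as ℕ using (ℕ; zero; suc)
open import Data.Bool using (Bool; true; false; _∧_; not)
open import Data.Product using (Σ; ∃; _×_; _,_; proj₁; proj₂)
open import Data.Sum using (_⊎_)
open import Data.Empty using (⊥)
open import Data.List as List using (List; []; _∷_; _++_; length; concatMap)
open import Data.List.Membership.Propositional using (_∈_)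
open import Data.List.Relation.Unary.Unique.Propositional using (Unique)
open import Data.Vec as Vec using (Vec; []; _∷_)
open import Relation.Binary.PropositionalEquality using (_≡_; _≢_)
open import Relation.Binary.Definitions using (DecidableEquality)
open import Relation.Nullary using (¬_; Dec; yes; no)
open import Relation.Nullary.Decidable using (⌊_⌋)
open import Algebra.Structures using (IsCommutativeRing)

record FiniteField : Set₁ where
  field
    Carrier  : Set
    _+_ _*_  : Carrier → Carrier → Carrier
    -_       : Carrier → Carrier
    0# 1#    : Carrier
    isCommutativeRing : IsCommutativeRing _≡_ _+_ _*_ -_ 0# 1#
    _≟_      : DecidableEquality Carrier
    0≢1      : 0# ≢ 1#
    inverse  : ∀ x → x ≢ 0# → Σ Carrier (λ y → x * y ≡ 1#)
    elements : List Carrier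
    complete : ∀ x → x ∈ elements
    unique   : Unique elements

  infixl 6 _+_
  infixl 7 _*_

  order : ℕ
  order = length elements

  -- the canonical image of k ∈ ℕ in F; these are exactly the elements of
  -- the prime subfield F_p
  _×1 : ℕ → Carrier
  zero ×1  = 0#
  suc k ×1 = 1# + k ×1

  isZero : Carrier → Bool
  isZero x = ⌊ x ≟ 0# ⌋

  _·_ : ∀ {k} → Vec Carrier k → Vec Carrier k → Carrier
  []      · []      = 0#
  (a ∷ u) · (b ∷ v) = a * b + u · v

  allVecs : (k : ℕ) → List (Vec Carrier k)
  allVecs zero    = [] ∷ []
  allVecs (suc k) = concatMap (λ a → List.map (a ∷_) (allVecs k)) elements

  -- the points of PG(k-1,q), each given by its unique normalised
  -- representative (first nonzero coordinate equal to 1)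
  points : (k : ℕ) → List (Vec Carrier k)
  points zero    = []
  points (suc k) = List.map (1# ∷_) (allVecs k) ++ List.map (0# ∷_) (points k)

  NonZeroVec : ∀ {k} → Vec Carrier k → Set
  NonZeroVec v = ¬ (v ≡ Vec.replicate _ 0#)

  scale : ∀ {k} → Carrier → Vec Carrier k → Vec Carrier k
  scale t v = Vec.map (t *_) v

  Proportional : ∀ {k} → Vec Carrier k → Vec Carrier k → Set
  Proportional v w = Σ Carrier (λ t → v ≡ scale t w)

  count : ∀ {A : Set} → (A → Bool) → List A → ℕ
  count f []       = 0
  count f (x ∷ xs) with f x
  ... | true  = suc (count f xs)
  ... | false = count f xs

  -- A hyperplane of PG(n,q) is given by a
  -- nonzero covector a ∈ F^{n+1}: H_a = {P : a·P = 0}.  A code word is an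
  -- F_p-linear combination  Σ λ_i H_i ; coefficients λ_i ∈ F_p are given
  -- as natural numbers (mapped to F_p ⊆ F by _×1).  Its value at a point
  -- (any representative vector) is Σ λ_i [P ∈ H_i] ∈ F_p ⊆ F.

  Hyperplane : ℕ → Set
  Hyperplane n = Σ (Vec Carrier (suc n)) NonZeroVec

  Codeword : ℕ → Set
  Codeword n = List (ℕ × Hyperplane n)

  eval : ∀ {n} → Codeword n → Vec Carrier (suc n) → Carrier
  eval []                  v = 0#
  eval ((λi , (a , _)) ∷ c) v with (a · v) ≟ 0#
  ... | yes _ = λi ×1 + eval c v
  ... | no  _ = eval c v

  -- A plane π of PG(n,q), given by three linearly independent vectors
  -- u₀,u₁,u₂ ∈ F^{n+1}; this identifies π with PG(2,q) via
  -- (x₀,x₁,x₂) ↦ x₀u₀ + x₁u₁ + x₂u₂.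

  combine : ∀ {m} → Vec Carrier 3 → Vec (Vec Carrier m) 3 → Vec Carrier m
  combine (x₀ ∷ x₁ ∷ x₂ ∷ []) (u₀ ∷ u₁ ∷ u₂ ∷ []) =
    Vec.zipWith _+_ (scale x₀ u₀) (Vec.zipWith _+_ (scale x₁ u₁) (scale x₂ u₂))

  record Plane (n : ℕ) : Set where
    field
      basis       : Vec (Vec Carrier (suc n)) 3
      independent : ∀ x → combine x basis ≡ Vec.replicate _ 0# → x ≡ Vec.replicate _ 0#

  -- the restriction c|_π, as a function on coordinate vectors of PG(2,q)
  restrict : ∀ {n} → Codeword n → Plane n → Vec Carrier 3 → Carrier
  restrict c π x = eval c (combine x (Plane.basis π))

  -- Code words of PG(2,q) (functions on points, given on representatives).
  -- Lines of PG(2,q) are given by nonzero covectors b ∈ F^3.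

  Line2 : Set
  Line2 = Σ (Vec Carrier 3) NonZeroVec

  lineFn : Line2 → Vec Carrier 3 → Carrier
  lineFn (b , _) x with (b · x) ≟ 0#
  ... | yes _ = 1#
  ... | no  _ = 0#

  -- f is an F_p-linear combination of at most two lines
  -- (types T_0, T_{q+1}, T_{2q}, T_{2q+1})
  TypeTw : (Vec Carrier 3 → Carrier) → Set
  TypeTw f = Σ ℕ λ λ₁ → Σ ℕ λ λ₂ → Σ Line2 λ ℓ₁ → Σ Line2 λ ℓ₂ →
    ∀ x → x ∈ points 3 → f x ≡ λ₁ ×1 * lineFn ℓ₁ x + λ₂ ×1 * lineFn ℓ₂ x

  OnLine : Line2 → Vec Carrier 3 → Set
  OnLine (b , _) x = b · x ≡ 0#

  Concurrent : Line2 → Line2 → Line2 → Set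
  Concurrent ℓ₁ ℓ₂ ℓ₃ =
    Σ (Vec Carrier 3) λ x → x ∈ points 3 × OnLine ℓ₁ x × OnLine ℓ₂ x × OnLine ℓ₃ x

  Comb3 : (Vec Carrier 3 → Carrier) → Line2 → Line2 → Line2 → Set
  Comb3 f ℓ₁ ℓ₂ ℓ₃ = Σ ℕ λ λ₁ → Σ ℕ λ λ₂ → Σ ℕ λ λ₃ →
    ∀ x → x ∈ points 3 →
      f x ≡ λ₁ ×1 * lineFn ℓ₁ x + λ₂ ×1 * lineFn ℓ₂ x + λ₃ ×1 * lineFn ℓ₃ x

  TypeTriangle : (Vec Carrier 3 → Carrier) → Set
  TypeTriangle f = Σ Line2 λ ℓ₁ → Σ Line2 λ ℓ₂ → Σ Line2 λ ℓ₃ →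
    ¬ Concurrent ℓ₁ ℓ₂ ℓ₃ × Comb3 f ℓ₁ ℓ₂ ℓ₃

  TypeStar : (Vec Carrier 3 → Carrier) → Set
  TypeStar f = Σ Line2 λ ℓ₁ → Σ Line2 λ ℓ₂ → Σ Line2 λ ℓ₃ →
    Concurrent ℓ₁ ℓ₂ ℓ₃ × Comb3 f ℓ₁ ℓ₂ ℓ₃

  -- the code word c₀ of PG(2,p), evaluated at normalised representatives:
  -- c₀(0,1,a) = a, c₀(1,0,b) = b, c₀(1,1,e) = -e, 0 elsewhere.
  c₀ : Vec Carrier 3 → Carrier
  c₀ (y₀ ∷ y₁ ∷ y₂ ∷ []) with y₀ ≟ 0# | y₀ ≟ 1# | y₁ ≟ 0# | y₁ ≟ 1#
  ... | yes _ | _     | _     | yes _ = y₂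
  ... | no _  | yes _ | yes _ | _     = y₂
  ... | no _  | yes _ | no _  | yes _ = - y₂
  ... | _     | _     | _     | _     = 0#

  m-line m′-line m″-line : Vec Carrier 3
  m-line  = 1# ∷ 0# ∷ 0# ∷ []
  m′-line = 0# ∷ 1# ∷ 0# ∷ []
  m″-line = 1# ∷ (- 1#) ∷ 0# ∷ []

  indicator : Vec Carrier 3 → Vec Carrier 3 → Carrier
  indicator b y with (b · y) ≟ 0#
  ... | yes _ = 1#
  ... | no  _ = 0#

  oddWord : ℕ → ℕ → ℕ → ℕ → Vec Carrier 3 → Carrier
  oddWord γ λ₁ λ₂ λ₃ y =
    γ ×1 * c₀ y + λ₁ ×1 * indicator m-line y
      + λ₂ ×1 * indicator m′-line y + λ₃ ×1 * indicator m″-line y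

  Matrix3 : Set
  Matrix3 = Vec (Vec Carrier 3) 3

  _⊛_ : Matrix3 → Vec Carrier 3 → Vec Carrier 3
  A ⊛ x = Vec.map (_· x) A

  -- type T^odd (only for q = p an odd prime, i.e. h = 1 and p ≠ 2):
  -- f = g^σ with g = γ c₀ + λ m + λ' m' + λ'' m'', γ ≠ 0, σ a collineation
  -- of PG(2,p) (for q = p prime, every collineation is induced by an
  -- invertible 3×3 matrix A); f(x) = g(y) where y is the normalised
  -- representative of A x.
  TypeOdd : ℕ → ℕ → (Vec Carrier 3 → Carrier) → Set
  TypeOdd p h f =
    h ≡ 1 × p ≢ 2 ×
    (Σ ℕ λ γ → Σ ℕ λ λ₁ → Σ ℕ λ λ₂ → Σ ℕ λ λ₃ → Σ Matrix3 λ A → Σ Matrix3 λ B →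
      γ ×1 ≢ 0# ×
      (∀ x → B ⊛ (A ⊛ x) ≡ x) ×
      (∀ x y → x ∈ points 3 → y ∈ points 3 → Proportional y (A ⊛ x) →
         f x ≡ oddWord γ λ₁ λ₂ λ₃ y))

  TypeCalT : ℕ → ℕ → (Vec Carrier 3 → Carrier) → Set
  TypeCalT p h f = TypeTw f ⊎ TypeOdd p h f ⊎ TypeTriangle f ⊎ TypeStar f

  secancy : (Vec Carrier 3 → Carrier) → Line2 → ℕ
  secancy f (b , _) = count (λ x → isZero (b · x) ∧ not (isZero (f x))) (points 3)

open FiniteField public

module Submission where

-- Everything happens inside π ≅ PG(2,q): c only enters through its
-- restriction f = c|_π, whose type is assumed.  The proof rests on two incidence facts of PG(2,q):
--   (I1) every line has at least q + 1 points                 (line-size);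
--   (I2) a line lies in another or meets it in ≤ 1 point      (two-lines),
--        proved with the cross product of two distinct points.
-- From these:
--   * a combination of k lines is constant on a line b off at most k points,
--     and off fewer than k when the constant is nonzero; so b is a ≤ k- or
--     ≥ (q+2-k)-secant (combination-secancy).  k = 2 is T_w; k = 3 is T^△, T^⋆.
--   * for T^odd, f = g ∘ σ with supp g ⊆ m ∪ m′ ∪ m″, and g is affine with
--     nonzero slope on each of these lines off their common point.  A line is
--     either the preimage of one of them (≤ 2 zeros of f, hence ≥ q - 1 support
--     points), or meets each of the three preimages in ≤ 1 point (≤ 3 support
--     points) (OddSecancy).

open import Data.Nat using (ℕ; _≤_; _∸_; _^_)
open import Data.Nat.Primality using (Prime)
open import Data.Sum using (_⊎_)
open import Data.Product using (_×_)
open import Relation.Binary.PropositionalEquality using (_≡_)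

open import Data.Nat as ℕ using (zero; suc; z≤n; s≤s)
import Data.Nat.Properties as ℕP
open import Data.Integer as ℤ using (ℤ; -[1+_]; _⊖_; _◃_)
import Data.Integer.Properties as ℤP
open import Data.Sign as Sign using (Sign)
open import Data.Bool as Bool using (Bool; true; false; _∧_; not)
open import Data.Empty using (⊥; ⊥-elim)
open import Function using (_$_)
open import Data.Maybe as Maybe using (Maybe)
open import Data.Sum using (inj₁; inj₂)
open import Data.Product using (Σ; ∃; _,_; proj₁; proj₂)
open import Data.List as List using (List; []; _∷_; length)
import Data.List.Properties as ListP
open import Data.List.Membership.Propositional using (_∈_; find; lose)
open import Data.List.Membership.Propositional.Properties
  using (∈-map⁺; ∈-map⁻; ∈-++⁺ˡ; ∈-++⁺ʳ; ∈-++⁻; ∈-concatMap⁺)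
open import Data.List.Relation.Unary.Any as Any using (here; there; any?)
import Data.List.Relation.Unary.All as All
import Data.List.Relation.Unary.All.Properties as AllP
import Data.List.Relation.Unary.AllPairs as AllPairs
import Data.List.Relation.Unary.AllPairs.Properties as AllPairsP
open import Data.List.Relation.Unary.Unique.Propositional using (Unique)
import Data.List.Relation.Unary.Unique.Propositional.Properties as Unique
open import Data.List.Relation.Binary.Disjoint.Propositional using (Disjoint)
open import Data.Fin using (Fin; zero; suc)
open import Data.Vec as Vec using (Vec; []; _∷_)
open import Data.Vec.Properties using (∷-injectiveˡ; ∷-injectiveʳ; ≡-dec)
open import Relation.Nullary using (¬_; yes; no)
open import Relation.Nullary.Decidable using (dec⇒maybe; ⌊_⌋)
open import Relation.Binary.PropositionalEquality
  using (refl; sym; trans; cong; cong₂; subst; _≢_; module ≡-Reasoning)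
open import Algebra.Bundles using (CommutativeRing)
open import Algebra.Structures using (IsCommutativeRing)
open import Algebra.Solver.Ring.AlmostCommutativeRing
  using (fromCommutativeRing; _-Raw-AlmostCommutative⟶_)

-- Defs is opened in full only for the final statement: its exported record
-- projections would clash with the operations of the fixed field F opened
-- in PlaneGeometry.
import Defs
open Defs using (FiniteField; module FiniteField)

-- A ring solver for any commutative ring R with propositional equality,
-- with integer coefficients interpreted through the canonical map ℤ → R.
-- Equality of integer coefficients is decided by computation, so normal
-- forms can be compared and 'solve n (λ … → lhs := rhs) refl' goes through
-- (with coefficients from R itself the comparison would be stuck).
module IntegerRingSolver {R : Set} {add mul : R → R → R} {neg : R → R} {r₀ r₁ : R}
  (isCommutativeRing : IsCommutativeRing _≡_ add mul neg r₀ r₁) where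
  open ≡-Reasoning

  commutativeRing : CommutativeRing _ _
  commutativeRing = record { isCommutativeRing = isCommutativeRing }

  open CommutativeRing commutativeRing
    using (_+_; _*_; -_; 0#; 1#; +-assoc; +-comm; +-identityˡ; +-identityʳ; -‿inverseʳ; ring; semiring)
  open import Algebra.Properties.Ring ring using (-‿distribˡ-*; -‿distribʳ-*; -‿involutive; -‿+-comm; -0#≈0#)
  open import Algebra.Properties.Semiring.Mult.TCOptimised semiring
    using (1+×; ×-homo-+; ×1-homo-*) renaming (_×_ to _×′_)

  _-_ : R → R → R
  x - y = x + - y
  infixl 6 _-_

  ι : ℕ → R
  ι n = n ×′ 1#

  ⟦_⟧ℤ : ℤ → R
  ⟦ ℤ.+ n ⟧ℤ    = ι n
  ⟦ -[1+ n ] ⟧ℤ = - ι (suc n)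

  -- (x + a) - (x + b) = a - b, needed for the recursion of _⊖_
  shift-difference : ∀ x a b → (x + a) - (x + b) ≡ a - b
  shift-difference x a b = begin
    (x + a) + - (x + b)     ≡⟨ cong ((x + a) +_) (sym (-‿+-comm x b)) ⟩
    (x + a) + (- x + - b)   ≡⟨ +-assoc x a (- x + - b) ⟩
    x + (a + (- x + - b))   ≡⟨ cong (x +_) (sym (+-assoc a (- x) (- b))) ⟩
    x + ((a + - x) + - b)   ≡⟨ cong (λ t → x + (t + - b)) (+-comm a (- x)) ⟩
    x + ((- x + a) + - b)   ≡⟨ cong (x +_) (+-assoc (- x) a (- b)) ⟩
    x + (- x + (a + - b))   ≡⟨ sym (+-assoc x (- x) (a - b)) ⟩
    (x + - x) + (a + - b)   ≡⟨ cong (_+ (a - b)) (-‿inverseʳ x) ⟩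
    0# + (a + - b)          ≡⟨ +-identityˡ (a - b) ⟩
    a - b                   ∎

  ⟦⊖⟧ : ∀ m n → ⟦ m ⊖ n ⟧ℤ ≡ ι m - ι n
  ⟦⊖⟧ zero    zero    = sym (trans (cong (0# +_) -0#≈0#) (+-identityʳ 0#))
  ⟦⊖⟧ zero    (suc n) = sym (+-identityˡ _)
  ⟦⊖⟧ (suc m) zero    = sym (trans (cong (ι (suc m) +_) -0#≈0#) (+-identityʳ _))
  ⟦⊖⟧ (suc m) (suc n) = begin
    ⟦ suc m ⊖ suc n ⟧ℤ           ≡⟨ cong ⟦_⟧ℤ (ℤP.[1+m]⊖[1+n]≡m⊖n m n) ⟩
    ⟦ m ⊖ n ⟧ℤ                   ≡⟨ ⟦⊖⟧ m n ⟩
    ι m - ι n                    ≡⟨ sym (shift-difference 1# (ι m) (ι n)) ⟩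
    (1# + ι m) - (1# + ι n)      ≡⟨ sym (cong₂ _-_ (1+× m 1#) (1+× n 1#)) ⟩
    ι (suc m) - ι (suc n)        ∎

  ⟦+⟧ : ∀ i j → ⟦ i ℤ.+ j ⟧ℤ ≡ ⟦ i ⟧ℤ + ⟦ j ⟧ℤ
  ⟦+⟧ (ℤ.+ m)  (ℤ.+ n)  = ×-homo-+ 1# m n
  ⟦+⟧ (ℤ.+ m)  -[1+ n ] = ⟦⊖⟧ m (suc n)
  ⟦+⟧ -[1+ m ] (ℤ.+ n)  = trans (⟦⊖⟧ n (suc m)) (+-comm _ _)
  ⟦+⟧ -[1+ m ] -[1+ n ] = begin
    - ι (suc (suc (m ℕ.+ n)))      ≡⟨ cong (λ k → - ι (suc k)) (sym (ℕP.+-suc m n)) ⟩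
    - ι (suc m ℕ.+ suc n)          ≡⟨ cong -_ (×-homo-+ 1# (suc m) (suc n)) ⟩
    - (ι (suc m) + ι (suc n))      ≡⟨ sym (-‿+-comm _ _) ⟩
    - ι (suc m) + - ι (suc n)      ∎

  ⟦-⟧ : ∀ i → ⟦ ℤ.- i ⟧ℤ ≡ - ⟦ i ⟧ℤ
  ⟦-⟧ (ℤ.+ zero)  = sym -0#≈0#
  ⟦-⟧ (ℤ.+ suc n) = refl
  ⟦-⟧ -[1+ n ]    = sym (-‿involutive _)

  signed : Sign → R → R
  signed Sign.+ x = x
  signed Sign.- x = - x

  ⟦◃⟧ : ∀ s n → ⟦ s ◃ n ⟧ℤ ≡ signed s (ι n)
  ⟦◃⟧ Sign.+ zero    = refl
  ⟦◃⟧ Sign.- zero    = sym -0#≈0#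
  ⟦◃⟧ Sign.+ (suc n) = refl
  ⟦◃⟧ Sign.- (suc n) = refl

  ⟦⟧-sign : ∀ i → ⟦ i ⟧ℤ ≡ signed (ℤ.sign i) (ι ℤ.∣ i ∣)
  ⟦⟧-sign (ℤ.+ n)  = refl
  ⟦⟧-sign -[1+ n ] = refl

  signed-* : ∀ s t x y → signed (s Sign.* t) (x * y) ≡ signed s x * signed t y
  signed-* Sign.+ Sign.+ x y = refl
  signed-* Sign.+ Sign.- x y = -‿distribʳ-* x y
  signed-* Sign.- Sign.+ x y = -‿distribˡ-* x y
  signed-* Sign.- Sign.- x y = begin
    x * y           ≡⟨ sym (-‿involutive _) ⟩
    - - (x * y)     ≡⟨ cong -_ (-‿distribˡ-* x y) ⟩
    - (- x * y)     ≡⟨ -‿distribʳ-* (- x) y ⟩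
    - x * - y       ∎

  ⟦*⟧ : ∀ i j → ⟦ i ℤ.* j ⟧ℤ ≡ ⟦ i ⟧ℤ * ⟦ j ⟧ℤ
  ⟦*⟧ i j = begin
    ⟦ s ◃ (ℤ.∣ i ∣ ℕ.* ℤ.∣ j ∣) ⟧ℤ             ≡⟨ ⟦◃⟧ s (ℤ.∣ i ∣ ℕ.* ℤ.∣ j ∣) ⟩
    signed s (ι (ℤ.∣ i ∣ ℕ.* ℤ.∣ j ∣))         ≡⟨ cong (signed s) (×1-homo-* ℤ.∣ i ∣ ℤ.∣ j ∣) ⟩
    signed s (ι ℤ.∣ i ∣ * ι ℤ.∣ j ∣)           ≡⟨ signed-* (ℤ.sign i) (ℤ.sign j) _ _ ⟩
    signed (ℤ.sign i) (ι ℤ.∣ i ∣) * signed (ℤ.sign j) (ι ℤ.∣ j ∣)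
                                              ≡⟨ sym (cong₂ _*_ (⟦⟧-sign i) (⟦⟧-sign j)) ⟩
    ⟦ i ⟧ℤ * ⟦ j ⟧ℤ                            ∎
    where s = ℤ.sign i Sign.* ℤ.sign j

  ℤ⟶R : ℤ.+-*-rawRing -Raw-AlmostCommutative⟶ fromCommutativeRing commutativeRing
  ℤ⟶R = record
    { ⟦_⟧ = ⟦_⟧ℤ ; +-homo = ⟦+⟧ ; *-homo = ⟦*⟧ ; -‿homo = ⟦-⟧ ; 0-homo = refl ; 1-homo = refl }

  -- equal integer coefficients have equal images (the solver's weak decision)
  ℤ-equal? : ∀ i j → Maybe (⟦ i ⟧ℤ ≡ ⟦ j ⟧ℤ)
  ℤ-equal? i j = Maybe.map (cong ⟦_⟧ℤ) (dec⇒maybe (i ℤ.≟ j))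

  open import Algebra.Solver.Ring ℤ.+-*-rawRing (fromCommutativeRing commutativeRing) ℤ⟶R ℤ-equal?
    public using (solve; _:=_; Polynomial; con; _:+_; _:*_; _:-_; :-_)

module PlaneGeometry (F : FiniteField) where
  open FiniteField F
  open IntegerRingSolver isCommutativeRing
  open CommutativeRing commutativeRing
    using (+-assoc; +-comm; *-comm; *-assoc; +-identityˡ; +-identityʳ; *-identityˡ; *-identityʳ;
           -‿inverseʳ; zeroˡ; zeroʳ; ring)
  open import Algebra.Properties.Ring ring using (-‿involutive; -0#≈0#)
  open ≡-Reasoning

  ∧-elimˡ : ∀ {a b} → a ∧ b ≡ true → a ≡ true
  ∧-elimˡ {true} _ = refl

  ∧-elimʳ : ∀ {a b} → a ∧ b ≡ true → b ≡ true
  ∧-elimʳ {true} b≡true = b≡true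

  ∧-intro : ∀ {a b} → a ≡ true → b ≡ true → a ∧ b ≡ true
  ∧-intro refl refl = refl

  bit : Bool → ℕ
  bit true  = 1
  bit false = 0

  count-∷ : ∀ {A : Set} (f : A → Bool) x xs → count f (x ∷ xs) ≡ bit (f x) ℕ.+ count f xs
  count-∷ f x xs with f x
  ... | true  = refl
  ... | false = refl

  count-none : ∀ {A : Set} (f : A → Bool) xs → (∀ x → x ∈ xs → f x ≡ false) → count f xs ≡ 0
  count-none f []       none = refl
  count-none f (x ∷ xs) none rewrite count-∷ f x xs | none x (here refl) =
    count-none f xs (λ y y∈xs → none y (there y∈xs))

  bit-cover : ∀ a b c → (a ≡ true → b ≡ true ⊎ c ≡ true) → bit a ≤ bit b ℕ.+ bit c
  bit-cover false b     c     _     = z≤n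
  bit-cover true  true  c     _     = s≤s z≤n
  bit-cover true  false true  _     = s≤s z≤n
  bit-cover true  false false cover with cover refl
  ... | inj₁ ()
  ... | inj₂ ()

  count-cover : ∀ {A : Set} (f g h : A → Bool) xs →
    (∀ x → x ∈ xs → f x ≡ true → g x ≡ true ⊎ h x ≡ true) →
    count f xs ≤ count g xs ℕ.+ count h xs
  count-cover f g h []       cover = z≤n
  count-cover f g h (x ∷ xs) cover =
    ℕP.≤-trans (ℕP.≤-reflexive (count-∷ f x xs))
   (ℕP.≤-trans (ℕP.+-mono-≤ (bit-cover (f x) (g x) (h x) (cover x (here refl)))
                            (count-cover f g h xs (λ y y∈xs → cover y (there y∈xs))))
   (ℕP.≤-reflexive (trans (interchange (bit (g x)) (bit (h x)) (count g xs) (count h xs))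
                          (sym (cong₂ ℕ._+_ (count-∷ g x xs) (count-∷ h x xs))))))
    where open import Algebra.Properties.CommutativeSemigroup ℕP.+-commutativeSemigroup
            using (interchange)

  count-mono : ∀ {A : Set} (f g : A → Bool) xs → (∀ x → x ∈ xs → f x ≡ true → g x ≡ true) → count f xs ≤ count g xs
  count-mono f g xs f⊆g =
    ℕP.≤-trans (count-cover f g (λ _ → false) xs (λ x x∈ fx → inj₁ (f⊆g x x∈ fx)))
               (ℕP.≤-reflexive (trans (cong (count g xs ℕ.+_) (count-none _ xs (λ _ _ → refl))) (ℕP.+-identityʳ _)))

  count-≤1 : ∀ {A : Set} (f : A → Bool) xs → Unique xs →
    (∀ x y → x ∈ xs → y ∈ xs → f x ≡ true → f y ≡ true → x ≡ y) → count f xs ≤ 1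
  count-≤1 f []       _               _   = z≤n
  count-≤1 f (x ∷ xs) (x∉xs AllPairs.∷ unique) one with f x in fx
  ... | true  = s≤s (ℕP.≤-reflexive (count-none f xs others))
    where
    others : ∀ y → y ∈ xs → f y ≡ false
    others y y∈xs with f y in fy
    ... | false = refl
    ... | true  = ⊥-elim (All.lookup x∉xs y∈xs (one x y (here refl) (there y∈xs) fx fy))
  ... | false = count-≤1 f xs unique (λ y z y∈ z∈ → one y z (there y∈) (there z∈))

  remove : ∀ {A : Set} {y : A} (zs : List A) → y ∈ zs → List A
  remove (z ∷ zs) (here _)    = zs
  remove (z ∷ zs) (there y∈) = z ∷ remove zs y∈

  length-remove : ∀ {A : Set} {y : A} (zs : List A) (y∈ : y ∈ zs) → length zs ≡ suc (length (remove zs y∈))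
  length-remove (z ∷ zs) (here _)    = refl
  length-remove (z ∷ zs) (there y∈) = cong suc (length-remove zs y∈)

  ∈-remove : ∀ {A : Set} {y z : A} (zs : List A) (y∈ : y ∈ zs) → z ∈ zs → z ≢ y → z ∈ remove zs y∈
  ∈-remove (_ ∷ zs) (here refl) (here refl) z≢y = ⊥-elim (z≢y refl)
  ∈-remove (_ ∷ zs) (here _)    (there z∈) _   = z∈
  ∈-remove (_ ∷ zs) (there y∈) (here refl) _   = here refl
  ∈-remove (_ ∷ zs) (there y∈) (there z∈) z≢y = there (∈-remove zs y∈ z∈ z≢y)

  unique-⊆-length : ∀ {A : Set} (ys zs : List A) → Unique ys → (∀ y → y ∈ ys → y ∈ zs) → length ys ≤ length zs
  unique-⊆-length []       zs _                  _   = z≤n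
  unique-⊆-length (y ∷ ys) zs (y∉ys AllPairs.∷ unique) ys⊆zs =
    ℕP.≤-trans (s≤s (unique-⊆-length ys (remove zs y∈zs) unique
                      (λ z z∈ys → ∈-remove zs y∈zs (ys⊆zs z (there z∈ys)) (λ z≡y → All.lookup y∉ys z∈ys (sym z≡y)))))
               (ℕP.≤-reflexive (sym (length-remove zs y∈zs)))
    where y∈zs = ys⊆zs y (here refl)

  select : ∀ {A : Set} (f : A → Bool) → List A → List A
  select f []       = []
  select f (x ∷ xs) with f x
  ... | true  = x ∷ select f xs
  ... | false = select f xs

  length-select : ∀ {A : Set} (f : A → Bool) xs → length (select f xs) ≡ count f xs
  length-select f []       = refl
  length-select f (x ∷ xs) with f x
  ... | true  = cong suc (length-select f xs)
  ... | false = length-select f xs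

  ∈-select : ∀ {A : Set} (f : A → Bool) {y} xs → y ∈ xs → f y ≡ true → y ∈ select f xs
  ∈-select f (x ∷ xs) (here refl) fy with f x
  ... | true  = here refl
  ... | false with () ← fy
  ∈-select f (x ∷ xs) (there y∈) fy with f x
  ... | true  = there (∈-select f xs y∈ fy)
  ... | false = ∈-select f xs y∈ fy

  count-≥ : ∀ {A : Set} (f : A → Bool) ys xs → Unique ys → (∀ y → y ∈ ys → y ∈ xs) → (∀ y → y ∈ ys → f y ≡ true) →
    length ys ≤ count f xs
  count-≥ f ys xs unique ys⊆xs holds =
    ℕP.≤-trans (unique-⊆-length ys (select f xs) unique (λ y y∈ → ∈-select f xs (ys⊆xs y y∈) (holds y y∈)))
               (ℕP.≤-reflexive (length-select f xs))

  isZero⇒≡0 : ∀ x → isZero x ≡ true → x ≡ 0#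
  isZero⇒≡0 x eq with x ≟ 0#
  ... | yes x≡0 = x≡0

  ≡0⇒isZero : ∀ x → x ≡ 0# → isZero x ≡ true
  ≡0⇒isZero x x≡0 with x ≟ 0#
  ... | yes _   = refl
  ... | no x≢0 = ⊥-elim (x≢0 x≡0)

  not-isZero⇒≢0 : ∀ x → not (isZero x) ≡ true → x ≢ 0#
  not-isZero⇒≢0 x nz x≡0 with x ≟ 0#
  ... | no x≢0 = x≢0 x≡0

  1≢0 : 1# ≢ 0#
  1≢0 1≡0 = 0≢1 (sym 1≡0)

  -≢0 : ∀ {x} → x ≢ 0# → - x ≢ 0#
  -≢0 {x} x≢0 -x≡0 = x≢0 (trans (sym (-‿involutive x)) (trans (cong -_ -x≡0) -0#≈0#))

  -1≢0 : - 1# ≢ 0#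
  -1≢0 = -≢0 1≢0

  inv : (x : Carrier) → x ≢ 0# → Carrier
  inv x x≢0 = proj₁ (inverse x x≢0)

  inv-r : ∀ x (x≢0 : x ≢ 0#) → x * inv x x≢0 ≡ 1#
  inv-r x x≢0 = proj₂ (inverse x x≢0)

  inv-l : ∀ x (x≢0 : x ≢ 0#) → inv x x≢0 * x ≡ 1#
  inv-l x x≢0 = trans (*-comm _ x) (inv-r x x≢0)

  inv≢0 : ∀ x (x≢0 : x ≢ 0#) → inv x x≢0 ≢ 0#
  inv≢0 x x≢0 inv≡0 = 1≢0 (trans (sym (inv-r x x≢0)) (trans (cong (x *_) inv≡0) (zeroʳ x)))

  scaled-zero : ∀ {s x} → x ≡ 0# → s * x ≡ 0#
  scaled-zero {s} refl = zeroʳ s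

  nonzero-factor : ∀ {x} y → x ≢ 0# → x * y ≡ 0# → y ≡ 0#
  nonzero-factor {x} y x≢0 xy≡0 = begin
    y                        ≡⟨ sym (*-identityˡ y) ⟩
    1# * y                   ≡⟨ cong (_* y) (sym (inv-l x x≢0)) ⟩
    (inv x x≢0 * x) * y      ≡⟨ *-assoc _ x y ⟩
    inv x x≢0 * (x * y)      ≡⟨ cong (inv x x≢0 *_) xy≡0 ⟩
    inv x x≢0 * 0#           ≡⟨ zeroʳ _ ⟩
    0#                       ∎

  difference-zero : ∀ y z → y - z ≡ 0# → y ≡ z
  difference-zero y z y-z≡0 = begin
    y                  ≡⟨ solve 2 (λ y z → y := (y :- z) :+ z) refl y z ⟩
    (y - z) + z        ≡⟨ cong (_+ z) y-z≡0 ⟩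
    0# + z             ≡⟨ +-identityˡ z ⟩
    z                  ∎

  cancelˡ : ∀ {x} y z → x ≢ 0# → x * y ≡ x * z → y ≡ z
  cancelˡ {x} y z x≢0 xy≡xz = difference-zero y z (nonzero-factor (y - z) x≢0 (begin
    x * (y - z)        ≡⟨ solve 3 (λ x y z → x :* (y :- z) := x :* y :- x :* z) refl x y z ⟩
    x * y - x * z      ≡⟨ cong (_- x * z) xy≡xz ⟩
    x * z - x * z      ≡⟨ -‿inverseʳ (x * z) ⟩
    0#                 ∎))

  Vec3 : Set
  Vec3 = Vec Carrier 3

  vec3-cong : ∀ {a b c a′ b′ c′ : Carrier} → a ≡ a′ → b ≡ b′ → c ≡ c′ →
    _≡_ {A = Vec3} (a ∷ b ∷ c ∷ []) (a′ ∷ b′ ∷ c′ ∷ [])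
  vec3-cong refl refl refl = refl

  PG2 : List Vec3
  PG2 = points 3

  allVecs-complete : ∀ k (v : Vec Carrier k) → v ∈ allVecs k
  allVecs-complete zero    []      = here refl
  allVecs-complete (suc k) (a ∷ v) =
    ∈-concatMap⁺ _ (Any.map (λ { refl → ∈-map⁺ (a ∷_) (allVecs-complete k v) }) (complete a))

  allVecs-unique : ∀ k → Unique (allVecs k)
  allVecs-unique zero    = All.[] AllPairs.∷ AllPairs.[]
  allVecs-unique (suc k) =
    Unique.concat⁺ (AllP.map⁺ (All.tabulate (λ _ → Unique.map⁺ ∷-injectiveʳ (allVecs-unique k))))
                   (AllPairsP.map⁺ (AllPairs.map disjoint unique))
    where
    disjoint : ∀ {a b} → a ≢ b → Disjoint (List.map (a ∷_) (allVecs k)) (List.map (b ∷_) (allVecs k))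
    disjoint a≢b (a∷v∈ , b∷w∈) with ∈-map⁻ _ a∷v∈ | ∈-map⁻ _ b∷w∈
    ... | _ , _ , refl | _ , _ , eq = a≢b (∷-injectiveˡ eq)

  points-unique : ∀ k → Unique (points k)
  points-unique zero    = AllPairs.[]
  points-unique (suc k) =
    Unique.++⁺ (Unique.map⁺ ∷-injectiveʳ (allVecs-unique k)) (Unique.map⁺ ∷-injectiveʳ (points-unique k)) disjoint
    where
    disjoint : Disjoint (List.map (1# ∷_) (allVecs k)) (List.map (0# ∷_) (points k))
    disjoint (v∈ , w∈) with ∈-map⁻ _ v∈ | ∈-map⁻ _ w∈
    ... | _ , _ , refl | _ , _ , eq = 1≢0 (∷-injectiveˡ eq)

  PG2-unique : Unique PG2
  PG2-unique = points-unique 3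

  data Normalised : Vec3 → Set where
    [1,a,b] : ∀ a b → Normalised (1# ∷ a ∷ b ∷ [])
    [0,1,a] : ∀ a   → Normalised (0# ∷ 1# ∷ a ∷ [])
    [0,0,1] :         Normalised (0# ∷ 0# ∷ 1# ∷ [])

  normalised : ∀ {x} → x ∈ PG2 → Normalised x
  normalised x∈ with ∈-++⁻ (List.map (1# ∷_) (allVecs 2)) x∈
  ... | inj₁ x∈₁ with ∈-map⁻ (1# ∷_) x∈₁
  ...   | (a ∷ b ∷ []) , _ , refl = [1,a,b] a b
  normalised x∈ | inj₂ x∈₂ with ∈-map⁻ (0# ∷_) x∈₂
  ... | v , v∈ , refl with ∈-++⁻ (List.map (1# ∷_) (allVecs 1)) v∈
  ...   | inj₁ v∈₁ with ∈-map⁻ (1# ∷_) v∈₁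
  ...     | (a ∷ []) , _ , refl = [0,1,a] a
  normalised x∈ | inj₂ x∈₂ | v , v∈ , refl | inj₂ v∈₂ with ∈-map⁻ (0# ∷_) v∈₂
  ... | u , u∈ , refl with ∈-++⁻ (List.map (1# ∷_) (allVecs 0)) u∈
  ...   | inj₁ u∈₁ with ∈-map⁻ (1# ∷_) u∈₁
  ...     | [] , _ , refl = [0,0,1]
  normalised x∈ | inj₂ x∈₂ | v , v∈ , refl | inj₂ v∈₂ | u , u∈ , refl | inj₂ ()

  [1,a,b]∈PG2 : ∀ a b → (1# ∷ a ∷ b ∷ []) ∈ PG2
  [1,a,b]∈PG2 a b = ∈-++⁺ˡ (∈-map⁺ (1# ∷_) (allVecs-complete 2 (a ∷ b ∷ [])))

  [0,1,a]∈PG2 : ∀ a → (0# ∷ 1# ∷ a ∷ []) ∈ PG2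
  [0,1,a]∈PG2 a = ∈-++⁺ʳ (List.map (1# ∷_) (allVecs 2))
    (∈-map⁺ (0# ∷_) (∈-++⁺ˡ (∈-map⁺ (1# ∷_) (allVecs-complete 1 (a ∷ [])))))

  [0,0,1]∈PG2 : (0# ∷ 0# ∷ 1# ∷ []) ∈ PG2
  [0,0,1]∈PG2 = ∈-++⁺ʳ (List.map (1# ∷_) (allVecs 2))
    (∈-map⁺ (0# ∷_) (∈-++⁺ʳ (List.map (1# ∷_) (allVecs 1)) (∈-map⁺ (0# ∷_) (here refl))))

  point≢0 : ∀ {x} → x ∈ PG2 → NonZeroVec x
  point≢0 x∈ x≡0 with normalised x∈
  ... | [1,a,b] _ _ = 1≢0 (∷-injectiveˡ x≡0)
  ... | [0,1,a] _   = 1≢0 (∷-injectiveˡ (∷-injectiveʳ x≡0))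
  ... | [0,0,1]     = 1≢0 (∷-injectiveˡ (∷-injectiveʳ (∷-injectiveʳ x≡0)))

  on : Vec3 → Vec3 → Bool
  on b x = isZero (b · x)

  _⊆ᴸ_ : Vec3 → Vec3 → Set
  b ⊆ᴸ c = ∀ z → z ∈ PG2 → on b z ≡ true → on c z ≡ true

  module _ {n : ℕ} where
    κ0 κ1 : Polynomial n
    κ0 = con (ℤ.+ 0)
    κ1 = con (ℤ.+ 1)

    dot3 : (u₀ u₁ u₂ z₀ z₁ z₂ : Polynomial n) → Polynomial n
    dot3 u₀ u₁ u₂ z₀ z₁ z₂ = u₀ :* z₀ :+ (u₁ :* z₁ :+ (u₂ :* z₂ :+ κ0))

  coord : Vec3 → Fin 3 → Carrier
  coord = Vec.lookup

  cross : Vec3 → Vec3 → Vec3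
  cross (x₀ ∷ x₁ ∷ x₂ ∷ []) (y₀ ∷ y₁ ∷ y₂ ∷ []) =
    (x₁ * y₂ - x₂ * y₁) ∷ (x₂ * y₀ - x₀ * y₂) ∷ (x₀ * y₁ - x₁ * y₀) ∷ []

  -- The triple product expansion, coordinatewise: for w = x × y,
  --   w_i (u·z) = u_i (w·z) + (x × z)_i (u·y) - (y × z)_i (u·x).
  triple-product : ∀ u x y z i → coord (cross x y) i * (u · z)
    ≡ coord u i * (cross x y · z) + (coord (cross x z) i * (u · y) - coord (cross y z) i * (u · x))
  triple-product (u₀ ∷ u₁ ∷ u₂ ∷ []) (x₀ ∷ x₁ ∷ x₂ ∷ []) (y₀ ∷ y₁ ∷ y₂ ∷ []) (z₀ ∷ z₁ ∷ z₂ ∷ []) zero =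
    solve 12 (λ u₀ u₁ u₂ x₀ x₁ x₂ y₀ y₁ y₂ z₀ z₁ z₂ →
      let w₀ = x₁ :* y₂ :- x₂ :* y₁ ; w₁ = x₂ :* y₀ :- x₀ :* y₂ ; w₂ = x₀ :* y₁ :- x₁ :* y₀ in
      w₀ :* dot3 u₀ u₁ u₂ z₀ z₁ z₂
        := u₀ :* dot3 w₀ w₁ w₂ z₀ z₁ z₂
           :+ ((x₁ :* z₂ :- x₂ :* z₁) :* dot3 u₀ u₁ u₂ y₀ y₁ y₂ :- (y₁ :* z₂ :- y₂ :* z₁) :* dot3 u₀ u₁ u₂ x₀ x₁ x₂))
      refl u₀ u₁ u₂ x₀ x₁ x₂ y₀ y₁ y₂ z₀ z₁ z₂
  triple-product (u₀ ∷ u₁ ∷ u₂ ∷ []) (x₀ ∷ x₁ ∷ x₂ ∷ []) (y₀ ∷ y₁ ∷ y₂ ∷ []) (z₀ ∷ z₁ ∷ z₂ ∷ []) (suc zero) =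
    solve 12 (λ u₀ u₁ u₂ x₀ x₁ x₂ y₀ y₁ y₂ z₀ z₁ z₂ →
      let w₀ = x₁ :* y₂ :- x₂ :* y₁ ; w₁ = x₂ :* y₀ :- x₀ :* y₂ ; w₂ = x₀ :* y₁ :- x₁ :* y₀ in
      w₁ :* dot3 u₀ u₁ u₂ z₀ z₁ z₂
        := u₁ :* dot3 w₀ w₁ w₂ z₀ z₁ z₂
           :+ ((x₂ :* z₀ :- x₀ :* z₂) :* dot3 u₀ u₁ u₂ y₀ y₁ y₂ :- (y₂ :* z₀ :- y₀ :* z₂) :* dot3 u₀ u₁ u₂ x₀ x₁ x₂))
      refl u₀ u₁ u₂ x₀ x₁ x₂ y₀ y₁ y₂ z₀ z₁ z₂
  triple-product (u₀ ∷ u₁ ∷ u₂ ∷ []) (x₀ ∷ x₁ ∷ x₂ ∷ []) (y₀ ∷ y₁ ∷ y₂ ∷ []) (z₀ ∷ z₁ ∷ z₂ ∷ []) (suc (suc zero)) =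
    solve 12 (λ u₀ u₁ u₂ x₀ x₁ x₂ y₀ y₁ y₂ z₀ z₁ z₂ →
      let w₀ = x₁ :* y₂ :- x₂ :* y₁ ; w₁ = x₂ :* y₀ :- x₀ :* y₂ ; w₂ = x₀ :* y₁ :- x₁ :* y₀ in
      w₂ :* dot3 u₀ u₁ u₂ z₀ z₁ z₂
        := u₂ :* dot3 w₀ w₁ w₂ z₀ z₁ z₂
           :+ ((x₀ :* z₁ :- x₁ :* z₀) :* dot3 u₀ u₁ u₂ y₀ y₁ y₂ :- (y₀ :* z₁ :- y₁ :* z₀) :* dot3 u₀ u₁ u₂ x₀ x₁ x₂))
      refl u₀ u₁ u₂ x₀ x₁ x₂ y₀ y₁ y₂ z₀ z₁ z₂

  orthogonal⇒∥cross : ∀ u x y → u · x ≡ 0# → u · y ≡ 0# →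
    ∀ i z → coord (cross x y) i * (u · z) ≡ coord u i * (cross x y · z)
  orthogonal⇒∥cross u x y ux≡0 uy≡0 i z = begin
    coord (cross x y) i * (u · z)
      ≡⟨ triple-product u x y z i ⟩
    coord u i * (cross x y · z) + (coord (cross x z) i * (u · y) - coord (cross y z) i * (u · x))
      ≡⟨ cong₂ (λ s t → coord u i * (cross x y · z) + (coord (cross x z) i * s - coord (cross y z) i * t)) uy≡0 ux≡0 ⟩
    coord u i * (cross x y · z) + (coord (cross x z) i * 0# - coord (cross y z) i * 0#)
      ≡⟨ solve 3 (λ a p r → a :+ (p :* κ0 :- r :* κ0) := a) refl _ _ _ ⟩
    coord u i * (cross x y · z) ∎

  orthogonal-to-all⇒0 : ∀ b → (∀ z → b · z ≡ 0#) → b ≡ Vec.replicate 3 0#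
  orthogonal-to-all⇒0 (b₀ ∷ b₁ ∷ b₂ ∷ []) ⊥all =
    vec3-cong (trans (sym (unit₀ b₀ b₁ b₂)) (⊥all (1# ∷ 0# ∷ 0# ∷ [])))
              (trans (sym (unit₁ b₀ b₁ b₂)) (⊥all (0# ∷ 1# ∷ 0# ∷ [])))
              (trans (sym (unit₂ b₀ b₁ b₂)) (⊥all (0# ∷ 0# ∷ 1# ∷ [])))
    where
    unit₀ : ∀ b₀ b₁ b₂ → (b₀ ∷ b₁ ∷ b₂ ∷ []) · (1# ∷ 0# ∷ 0# ∷ []) ≡ b₀
    unit₀ = solve 3 (λ b₀ b₁ b₂ → dot3 b₀ b₁ b₂ κ1 κ0 κ0 := b₀) refl
    unit₁ : ∀ b₀ b₁ b₂ → (b₀ ∷ b₁ ∷ b₂ ∷ []) · (0# ∷ 1# ∷ 0# ∷ []) ≡ b₁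
    unit₁ = solve 3 (λ b₀ b₁ b₂ → dot3 b₀ b₁ b₂ κ0 κ1 κ0 := b₁) refl
    unit₂ : ∀ b₀ b₁ b₂ → (b₀ ∷ b₁ ∷ b₂ ∷ []) · (0# ∷ 0# ∷ 1# ∷ []) ≡ b₂
    unit₂ = solve 3 (λ b₀ b₁ b₂ → dot3 b₀ b₁ b₂ κ0 κ0 κ1 := b₂) refl

  proportional⇒⊆ : ∀ (w b c : Vec3) i → coord w i ≢ 0# → NonZeroVec b →
    (∀ z → coord w i * (b · z) ≡ coord b i * (w · z)) →
    (∀ z → coord w i * (c · z) ≡ coord c i * (w · z)) →
    ∀ z → b · z ≡ 0# → c · z ≡ 0#
  proportional⇒⊆ w b c i wᵢ≢0 b≢0 b∥w c∥w z bz≡0 with coord b i ≟ 0#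
  ... | yes bᵢ≡0 = ⊥-elim (b≢0 (orthogonal-to-all⇒0 b (λ z′ →
          nonzero-factor (b · z′) wᵢ≢0 (trans (b∥w z′) (trans (cong (_* (w · z′)) bᵢ≡0) (zeroˡ _))))))
  ... | no bᵢ≢0 = nonzero-factor (c · z) wᵢ≢0
          (trans (c∥w z) (trans (cong (coord c i *_) wz≡0) (zeroʳ _)))
    where
    wz≡0 : w · z ≡ 0#
    wz≡0 = nonzero-factor (w · z) bᵢ≢0 (trans (sym (b∥w z)) (trans (cong (coord w i *_) bz≡0) (zeroʳ _)))

  is-one : ∀ {t} → t ≡ 1# → t ≡ 0# → ⊥
  is-one t≡1 t≡0 = 1≢0 (trans (sym t≡1) t≡0)

  is-minus-one : ∀ {t} → t ≡ - 1# → t ≡ 0# → ⊥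
  is-minus-one t≡-1 t≡0 = -1≢0 (trans (sym t≡-1) t≡0)

  cross≡0⇒≡ : ∀ {x y} → Normalised x → Normalised y → (∀ i → coord (cross x y) i ≡ 0#) → x ≡ y
  cross≡0⇒≡ ([1,a,b] a b) ([1,a,b] c d) w≡0 =
    cong₂ (λ s t → 1# ∷ s ∷ t ∷ [])
      (sym (difference-zero c a (trans (coordinate₂ a c) (w≡0 (suc (suc zero))))))
      (difference-zero b d (trans (coordinate₁ b d) (w≡0 (suc zero))))
    where
    coordinate₁ : ∀ b d → b - d ≡ b * 1# - 1# * d
    coordinate₁ = solve 2 (λ b d → b :- d := b :* κ1 :- κ1 :* d) refl
    coordinate₂ : ∀ a c → c - a ≡ 1# * c - a * 1#
    coordinate₂ = solve 2 (λ a c → c :- a := κ1 :* c :- a :* κ1) refl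
  cross≡0⇒≡ ([1,a,b] a b) ([0,1,a] c) w≡0 = ⊥-elim $ is-one (solve 1 (λ a → κ1 :* κ1 :- a :* κ0 := κ1) refl a) (w≡0 (suc (suc zero)))
  cross≡0⇒≡ ([1,a,b] a b) [0,0,1]     w≡0 = ⊥-elim $ is-minus-one (solve 1 (λ b → b :* κ0 :- κ1 :* κ1 := :- κ1) refl b) (w≡0 (suc zero))
  cross≡0⇒≡ ([0,1,a] a) ([1,a,b] b c) w≡0 = ⊥-elim $ is-minus-one (solve 1 (λ b → κ0 :* b :- κ1 :* κ1 := :- κ1) refl b) (w≡0 (suc (suc zero)))
  cross≡0⇒≡ ([0,1,a] a) ([0,1,a] b)   w≡0 =
    cong (λ t → 0# ∷ 1# ∷ t ∷ []) (sym (difference-zero b a (trans (coordinate₀ a b) (w≡0 zero))))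
    where
    coordinate₀ : ∀ a b → b - a ≡ 1# * b - a * 1#
    coordinate₀ = solve 2 (λ a b → b :- a := κ1 :* b :- a :* κ1) refl
  cross≡0⇒≡ ([0,1,a] a) [0,0,1]       w≡0 = ⊥-elim $ is-one (solve 1 (λ a → κ1 :* κ1 :- a :* κ0 := κ1) refl a) (w≡0 zero)
  cross≡0⇒≡ [0,0,1]     ([1,a,b] a b) w≡0 = ⊥-elim $ is-one (solve 1 (λ b → κ1 :* κ1 :- κ0 :* b := κ1) refl b) (w≡0 (suc zero))
  cross≡0⇒≡ [0,0,1]     ([0,1,a] a)   w≡0 = ⊥-elim $ is-minus-one (solve 1 (λ a → κ0 :* a :- κ1 :* κ1 := :- κ1) refl a) (w≡0 zero)
  cross≡0⇒≡ [0,0,1]     [0,0,1]       w≡0 = refl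

  distinct⇒cross≢0 : ∀ {x y} → x ∈ PG2 → y ∈ PG2 → x ≢ y → ∃ λ i → coord (cross x y) i ≢ 0#
  distinct⇒cross≢0 {x} {y} x∈ y∈ x≢y
    with coord (cross x y) zero ≟ 0# | coord (cross x y) (suc zero) ≟ 0# | coord (cross x y) (suc (suc zero)) ≟ 0#
  ... | no w₀≢0 | _        | _        = zero , w₀≢0
  ... | yes _   | no w₁≢0 | _        = suc zero , w₁≢0
  ... | yes _   | yes _    | no w₂≢0 = suc (suc zero) , w₂≢0
  ... | yes w₀≡0 | yes w₁≡0 | yes w₂≡0 = ⊥-elim (x≢y (cross≡0⇒≡ (normalised x∈) (normalised y∈)
          λ { zero → w₀≡0 ; (suc zero) → w₁≡0 ; (suc (suc zero)) → w₂≡0 }))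

  through-two-points : ∀ b c {x y} → NonZeroVec b → x ∈ PG2 → y ∈ PG2 → x ≢ y →
    b · x ≡ 0# → b · y ≡ 0# → c · x ≡ 0# → c · y ≡ 0# → ∀ z → b · z ≡ 0# → c · z ≡ 0#
  through-two-points b c {x} {y} b≢0 x∈ y∈ x≢y bx≡0 by≡0 cx≡0 cy≡0 with distinct⇒cross≢0 x∈ y∈ x≢y
  ... | i , wᵢ≢0 = proportional⇒⊆ (cross x y) b c i wᵢ≢0 b≢0
                     (orthogonal⇒∥cross b x y bx≡0 by≡0 i) (orthogonal⇒∥cross c x y cx≡0 cy≡0 i)

  two-lines : ∀ b c → NonZeroVec b → b ⊆ᴸ c ⊎ count (λ x → on b x ∧ on c x) PG2 ≤ 1
  two-lines b c b≢0 with any? (λ z → on b z ∧ not (on c z) Bool.≟ true) PG2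
  ... | no none = inj₁ λ z z∈ on-b → on-c z (λ off → none (lose z∈ off)) on-b
    where
    on-c : ∀ z → ¬ (on b z ∧ not (on c z) ≡ true) → on b z ≡ true → on c z ≡ true
    on-c z off on-b with on c z
    ... | true  = refl
    ... | false = ⊥-elim (off (cong (_∧ true) on-b))
  ... | yes some with find some
  ... | z , z∈ , z-off-c = inj₂ (count-≤1 _ PG2 PG2-unique at-most-one)
    where
    at-most-one : ∀ x y → x ∈ PG2 → y ∈ PG2 → on b x ∧ on c x ≡ true → on b y ∧ on c y ≡ true → x ≡ y
    at-most-one x y x∈ y∈ x-on y-on with ≡-dec _≟_ x y
    ... | yes x≡y = x≡y
    ... | no x≢y  = ⊥-elim (true≢false (trans (sym (∧-elimʳ z-off-c)) (cong not (≡0⇒isZero _ cz≡0))))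
      where
      cz≡0 : c · z ≡ 0#
      cz≡0 = through-two-points b c b≢0 x∈ y∈ x≢y
               (isZero⇒≡0 _ (∧-elimˡ x-on)) (isZero⇒≡0 _ (∧-elimˡ y-on))
               (isZero⇒≡0 _ (∧-elimʳ x-on)) (isZero⇒≡0 _ (∧-elimʳ y-on))
               z (isZero⇒≡0 _ (∧-elimˡ z-off-c))
      true≢false : true ≢ false
      true≢false ()

  times-1-1 : ∀ x → x * (1# - 1#) ≡ 0#
  times-1-1 = solve 1 (λ x → x :* (κ1 :- κ1) := κ0) refl

  family⇒≥q+1 : ∀ b (g : Carrier → Vec3) extra → (∀ {s t} → g s ≡ g t → s ≡ t) → (∀ t → extra ≢ g t) →
    (∀ t → g t ∈ PG2) → extra ∈ PG2 → (∀ t → b · g t ≡ 0#) → b · extra ≡ 0# → suc order ≤ count (on b) PG2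
  family⇒≥q+1 b g extra g-injective extra-new g∈ extra∈ g-on extra-on =
    ℕP.≤-trans (ℕP.≤-reflexive (cong suc (sym (ListP.length-map g elements))))
               (count-≥ (on b) (extra ∷ List.map g elements) PG2 distinct ⊆PG2 on-b)
    where
    distinct : Unique (extra ∷ List.map g elements)
    distinct = AllP.map⁺ (All.tabulate (λ {t} _ → extra-new t)) AllPairs.∷ Unique.map⁺ g-injective unique
    ⊆PG2 : ∀ y → y ∈ extra ∷ List.map g elements → y ∈ PG2
    ⊆PG2 y (here refl) = extra∈
    ⊆PG2 y (there y∈) with ∈-map⁻ g y∈
    ... | t , _ , refl = g∈ t
    on-b : ∀ y → y ∈ extra ∷ List.map g elements → on b y ≡ true
    on-b y (here refl) = ≡0⇒isZero _ extra-on
    on-b y (there y∈) with ∈-map⁻ g y∈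
    ... | t , _ , refl = ≡0⇒isZero _ (g-on t)

  -- (I1) for the three shapes of a nonzero covector: solve b·x = 0 for the
  -- last coordinate with nonzero coefficient, the other free coordinate
  -- parametrising the points; one further point completes the count.

  line-size-b₂≢0 : ∀ b₀ b₁ b₂ → b₂ ≢ 0# → suc order ≤ count (on (b₀ ∷ b₁ ∷ b₂ ∷ [])) PG2
  line-size-b₂≢0 b₀ b₁ b₂ b₂≢0 =
    family⇒≥q+1 B g extra (λ eq → ∷-injectiveˡ (∷-injectiveʳ eq)) (λ _ eq → 1≢0 (sym (∷-injectiveˡ eq)))
      (λ _ → [1,a,b]∈PG2 _ _) ([0,1,a]∈PG2 _) g-on extra-on
    where
    B = b₀ ∷ b₁ ∷ b₂ ∷ []
    s = inv b₂ b₂≢0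
    g : Carrier → Vec3
    g t = 1# ∷ t ∷ - (s * (b₀ + b₁ * t)) ∷ []
    extra = 0# ∷ 1# ∷ - (s * b₁) ∷ []
    g-on : ∀ t → B · g t ≡ 0#
    g-on t = trans (solve 5 (λ b₀ b₁ b₂ s t → dot3 b₀ b₁ b₂ κ1 t (:- (s :* (b₀ :+ b₁ :* t)))
                                                := (b₀ :+ b₁ :* t) :* (κ1 :- b₂ :* s)) refl b₀ b₁ b₂ s t)
             (trans (cong (λ u → (b₀ + b₁ * t) * (1# - u)) (inv-r b₂ b₂≢0)) (times-1-1 _))
    extra-on : B · extra ≡ 0#
    extra-on = trans (solve 4 (λ b₀ b₁ b₂ s → dot3 b₀ b₁ b₂ κ0 κ1 (:- (s :* b₁)) := b₁ :* (κ1 :- b₂ :* s)) refl b₀ b₁ b₂ s)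
               (trans (cong (λ u → b₁ * (1# - u)) (inv-r b₂ b₂≢0)) (times-1-1 _))

  line-size-b₁≢0 : ∀ b₀ b₁ b₂ → b₂ ≡ 0# → b₁ ≢ 0# → suc order ≤ count (on (b₀ ∷ b₁ ∷ b₂ ∷ [])) PG2
  line-size-b₁≢0 b₀ b₁ b₂ b₂≡0 b₁≢0 =
    family⇒≥q+1 B g extra (λ eq → ∷-injectiveˡ (∷-injectiveʳ (∷-injectiveʳ eq))) (λ _ eq → 1≢0 (sym (∷-injectiveˡ eq)))
      (λ _ → [1,a,b]∈PG2 _ _) [0,0,1]∈PG2 g-on extra-on
    where
    B = b₀ ∷ b₁ ∷ b₂ ∷ []
    s = inv b₁ b₁≢0
    g : Carrier → Vec3
    g t = 1# ∷ - (s * b₀) ∷ t ∷ []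
    extra = 0# ∷ 0# ∷ 1# ∷ []
    g-on : ∀ t → B · g t ≡ 0#
    g-on t = trans (solve 5 (λ b₀ b₁ b₂ s t → dot3 b₀ b₁ b₂ κ1 (:- (s :* b₀)) t := b₀ :* (κ1 :- b₁ :* s) :+ b₂ :* t)
                     refl b₀ b₁ b₂ s t)
             (trans (cong₂ (λ u v → b₀ * (1# - u) + v * t) (inv-r b₁ b₁≢0) b₂≡0)
                    (solve 2 (λ b₀ t → b₀ :* (κ1 :- κ1) :+ κ0 :* t := κ0) refl b₀ t))
    extra-on : B · extra ≡ 0#
    extra-on = trans (solve 3 (λ b₀ b₁ b₂ → dot3 b₀ b₁ b₂ κ0 κ0 κ1 := b₂) refl b₀ b₁ b₂) b₂≡0

  line-size-b₁≡b₂≡0 : ∀ b₀ b₁ b₂ → b₂ ≡ 0# → b₁ ≡ 0# → suc order ≤ count (on (b₀ ∷ b₁ ∷ b₂ ∷ [])) PG2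
  line-size-b₁≡b₂≡0 b₀ b₁ b₂ b₂≡0 b₁≡0 =
    family⇒≥q+1 B g extra (λ eq → ∷-injectiveˡ (∷-injectiveʳ (∷-injectiveʳ eq)))
      (λ _ eq → 1≢0 (sym (∷-injectiveˡ (∷-injectiveʳ eq)))) (λ _ → [0,1,a]∈PG2 _) [0,0,1]∈PG2 g-on extra-on
    where
    B = b₀ ∷ b₁ ∷ b₂ ∷ []
    g : Carrier → Vec3
    g t = 0# ∷ 1# ∷ t ∷ []
    extra = 0# ∷ 0# ∷ 1# ∷ []
    g-on : ∀ t → B · g t ≡ 0#
    g-on t = trans (solve 4 (λ b₀ b₁ b₂ t → dot3 b₀ b₁ b₂ κ0 κ1 t := b₁ :+ b₂ :* t) refl b₀ b₁ b₂ t)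
             (trans (cong₂ (λ u v → u + v * t) b₁≡0 b₂≡0) (solve 1 (λ t → κ0 :+ κ0 :* t := κ0) refl t))
    extra-on : B · extra ≡ 0#
    extra-on = trans (solve 3 (λ b₀ b₁ b₂ → dot3 b₀ b₁ b₂ κ0 κ0 κ1 := b₂) refl b₀ b₁ b₂) b₂≡0

  -- (I1) every line of PG(2,q) has at least q + 1 points (as does, trivially,
  -- the zero covector, which vanishes on every point)
  line-size : ∀ b → suc order ≤ count (on b) PG2
  line-size (b₀ ∷ b₁ ∷ b₂ ∷ []) with b₂ ≟ 0# | b₁ ≟ 0#
  ... | no b₂≢0  | _        = line-size-b₂≢0 b₀ b₁ b₂ b₂≢0
  ... | yes b₂≡0 | no b₁≢0  = line-size-b₁≢0 b₀ b₁ b₂ b₂≡0 b₁≢0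
  ... | yes b₂≡0 | yes b₁≡0 = line-size-b₁≡b₂≡0 b₀ b₁ b₂ b₂≡0 b₁≡0

  -- Secancies.  Points of a line are either in the support of f or zeros
  -- of f, so a line with at most z zeros of f is a (≥ q+1-z)-secant.
  few-zeros⇒long : ∀ (f : Vec3 → Carrier) (ℓ : Line2) z →
    count (λ x → on (proj₁ ℓ) x ∧ isZero (f x)) PG2 ≤ z → suc order ≤ secancy f ℓ ℕ.+ z
  few-zeros⇒long f ℓ z zeros≤z =
    ℕP.≤-trans (line-size (proj₁ ℓ))
   (ℕP.≤-trans (count-cover _ _ _ PG2 (λ x _ on-ℓ → support-or-zero (isZero (f x)) on-ℓ))
               (ℕP.+-monoʳ-≤ (secancy f ℓ) zeros≤z))
    where
    support-or-zero : ∀ {a} z → a ≡ true → a ∧ not z ≡ true ⊎ a ∧ z ≡ true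
    support-or-zero true  refl = inj₂ refl
    support-or-zero false refl = inj₁ refl

  combination : List (ℕ × Line2) → Vec3 → Carrier
  combination []             x = 0#
  combination ((w , ℓ) ∷ ls) x = w ×1 * lineFn ℓ x + combination ls x

  lineFn-on : ∀ (ℓ : Line2) x → on (proj₁ ℓ) x ≡ true → lineFn ℓ x ≡ 1#
  lineFn-on (c , _) x on-c with (c · x) ≟ 0#
  ... | yes _ = refl

  lineFn-off : ∀ (ℓ : Line2) x → on (proj₁ ℓ) x ≡ false → lineFn ℓ x ≡ 0#
  lineFn-off (c , _) x off-c with (c · x) ≟ 0#
  ... | no _ = refl

  record AlmostConstantOn (b : Vec3) (g : Vec3 → Carrier) (k : ℕ) : Set where
    field
      value       : Carrier
      exceptional : Vec3 → Bool
      constant    : ∀ x → x ∈ PG2 → on b x ≡ true → exceptional x ≡ false → g x ≡ value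
      few         : count (λ x → on b x ∧ exceptional x) PG2 ≤ k
      fewer       : value ≢ 0# → suc (count (λ x → on b x ∧ exceptional x) PG2) ≤ k

  -- A combination of k lines is almost constant on every line b: each ℓᵢ
  -- either contains b (and adds wᵢ to the value) or meets it in at most one
  -- point (which becomes exceptional).  If every ℓᵢ is of the second kind,
  -- the value is 0.
  combination-almost-constant : ∀ b → NonZeroVec b → ∀ ls → AlmostConstantOn b (combination ls) (length ls)
  combination-almost-constant b b≢0 [] = record
    { value = 0# ; exceptional = λ _ → false ; constant = λ _ _ _ _ → refl
    ; few = ℕP.≤-reflexive (count-none _ PG2 (λ x _ → ∧-false (on b x)))
    ; fewer = λ 0≢0 → ⊥-elim (0≢0 refl) }
    where
    ∧-false : ∀ a → a ∧ false ≡ false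
    ∧-false true  = refl
    ∧-false false = refl
  combination-almost-constant b b≢0 ((w , (c , c≢0)) ∷ ls) with two-lines b c b≢0
  ... | inj₁ b⊆c = record
    { value = w ×1 + value ; exceptional = exceptional
    ; constant = λ x x∈ on-b ordinary → cong₂ _+_
        (trans (cong (w ×1 *_) (lineFn-on (c , c≢0) x (b⊆c x x∈ on-b))) (*-identityʳ _))
        (constant x x∈ on-b ordinary)
    ; few = ℕP.m≤n⇒m≤1+n few
    ; fewer = λ _ → s≤s few }
    where open AlmostConstantOn (combination-almost-constant b b≢0 ls)
  ... | inj₂ meet≤1 = record
    { value = value ; exceptional = λ x → on c x Bool.∨ exceptional x
    ; constant = λ x x∈ on-b ordinary → trans
        (cong₂ _+_ (trans (cong (w ×1 *_) (lineFn-off (c , c≢0) x (∨-falseˡ ordinary))) (zeroʳ _))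
                   (constant x x∈ on-b (∨-falseʳ {on c x} ordinary)))
        (+-identityˡ value)
    ; few = ℕP.≤-trans split (s≤s few)
    ; fewer = λ value≢0 → s≤s (ℕP.≤-trans split (fewer value≢0)) }
    where
    open AlmostConstantOn (combination-almost-constant b b≢0 ls)
    ∨-falseˡ : ∀ {a a′} → a Bool.∨ a′ ≡ false → a ≡ false
    ∨-falseˡ {false} _ = refl
    ∨-falseʳ : ∀ {a a′} → a Bool.∨ a′ ≡ false → a′ ≡ false
    ∨-falseʳ {false} a′≡false = a′≡false
    ∧-∨-split : ∀ a a′ a″ → a ∧ (a′ Bool.∨ a″) ≡ true → a ∧ a′ ≡ true ⊎ a ∧ a″ ≡ true
    ∧-∨-split true true  _ _ = inj₁ refl
    ∧-∨-split true false _ e = inj₂ e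
    split : count (λ x → on b x ∧ (on c x Bool.∨ exceptional x)) PG2
              ≤ suc (count (λ x → on b x ∧ exceptional x) PG2)
    split = ℕP.≤-trans (count-cover _ _ _ PG2 (λ x _ → ∧-∨-split (on b x) (on c x) (exceptional x)))
                       (ℕP.+-monoˡ-≤ _ meet≤1)

  -- An almost constant function meets the line b in at most k points, or
  -- in at least q + 2 - k: if its value on b is 0 the support on b is
  -- exceptional, otherwise the zeros on b are (and there are fewer than k).
  almost-constant⇒secancy : ∀ (f g : Vec3 → Carrier) (ℓ : Line2) k → (∀ x → x ∈ PG2 → f x ≡ g x) →
    AlmostConstantOn (proj₁ ℓ) g k → secancy f ℓ ≤ k ⊎ suc (suc order) ≤ secancy f ℓ ℕ.+ k
  almost-constant⇒secancy f g ℓ@(b , _) k f≡g almost with AlmostConstantOn.value almost ≟ 0#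
  ... | yes value≡0 = inj₁ (ℕP.≤-trans (count-mono _ _ PG2 support⊆exceptional) few)
    where
    open AlmostConstantOn almost
    support⊆exceptional : ∀ x → x ∈ PG2 → on b x ∧ not (isZero (f x)) ≡ true → on b x ∧ exceptional x ≡ true
    support⊆exceptional x x∈ in-support with exceptional x in ex
    ... | true  = ∧-intro (∧-elimˡ in-support) refl
    ... | false = ⊥-elim (not-isZero⇒≢0 (f x) (∧-elimʳ in-support)
                    (trans (f≡g x x∈) (trans (constant x x∈ (∧-elimˡ in-support) ex) value≡0)))
  ... | no value≢0 = inj₂ (ℕP.≤-trans (s≤s (few-zeros⇒long f ℓ _ (count-mono _ _ PG2 zeros⊆exceptional)))
                                     (ℕP.≤-trans (ℕP.≤-reflexive (sym (ℕP.+-suc _ _))) (ℕP.+-monoʳ-≤ _ (fewer value≢0))))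
    where
    open AlmostConstantOn almost
    zeros⊆exceptional : ∀ x → x ∈ PG2 → on b x ∧ isZero (f x) ≡ true → on b x ∧ exceptional x ≡ true
    zeros⊆exceptional x x∈ zero-on-b with exceptional x in ex
    ... | true  = ∧-intro (∧-elimˡ zero-on-b) refl
    ... | false = ⊥-elim (value≢0 (trans (sym (constant x x∈ (∧-elimˡ zero-on-b) ex))
                    (trans (sym (f≡g x x∈)) (isZero⇒≡0 (f x) (∧-elimʳ zero-on-b)))))

  combination-secancy : ∀ (f : Vec3 → Carrier) ls → (∀ x → x ∈ PG2 → f x ≡ combination ls x) → (ℓ : Line2) →
    secancy f ℓ ≤ length ls ⊎ suc (suc order) ≤ secancy f ℓ ℕ.+ length ls
  combination-secancy f ls f≡ (b , b≢0) =
    almost-constant⇒secancy f (combination ls) (b , b≢0) (length ls) f≡ (combination-almost-constant b b≢0 ls)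

  type-Tw-secancy : ∀ f → TypeTw f → (ℓ : Line2) → secancy f ℓ ≤ 2 ⊎ order ≤ secancy f ℓ
  type-Tw-secancy f (w₁ , w₂ , ℓ₁ , ℓ₂ , f≡) ℓ
    with combination-secancy f ((w₁ , ℓ₁) ∷ (w₂ , ℓ₂) ∷ []) as-combination ℓ
    where
    as-combination : ∀ x → x ∈ PG2 → f x ≡ combination ((w₁ , ℓ₁) ∷ (w₂ , ℓ₂) ∷ []) x
    as-combination x x∈ = trans (f≡ x x∈) (cong (w₁ ×1 * lineFn ℓ₁ x +_) (sym (+-identityʳ _)))
  ... | inj₁ short = inj₁ short
  ... | inj₂ long  = inj₂ (ℕP.≤-pred (ℕP.≤-pred (ℕP.≤-trans long (ℕP.≤-reflexive (ℕP.+-comm _ 2)))))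

  three-lines-secancy : ∀ f ℓ₁ ℓ₂ ℓ₃ → Comb3 f ℓ₁ ℓ₂ ℓ₃ → (ℓ : Line2) → secancy f ℓ ≤ 3 ⊎ order ∸ 1 ≤ secancy f ℓ
  three-lines-secancy f ℓ₁ ℓ₂ ℓ₃ (w₁ , w₂ , w₃ , f≡) ℓ
    with combination-secancy f ((w₁ , ℓ₁) ∷ (w₂ , ℓ₂) ∷ (w₃ , ℓ₃) ∷ []) as-combination ℓ
    where
    as-combination : ∀ x → x ∈ PG2 → f x ≡ combination ((w₁ , ℓ₁) ∷ (w₂ , ℓ₂) ∷ (w₃ , ℓ₃) ∷ []) x
    as-combination x x∈ = trans (f≡ x x∈) (trans (+-assoc _ _ _)
      (cong (λ t → w₁ ×1 * lineFn ℓ₁ x + (w₂ ×1 * lineFn ℓ₂ x + t)) (sym (+-identityʳ _))))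
  ... | inj₁ short = inj₁ short
  ... | inj₂ long  = inj₂ (ℕP.∸-monoˡ-≤ 1 (ℕP.≤-pred (ℕP.≤-pred (ℕP.≤-trans long (ℕP.≤-reflexive (ℕP.+-comm _ 3))))))

  normalise : Vec3 → Vec3
  normalise (v₀ ∷ v₁ ∷ v₂ ∷ []) with v₀ ≟ 0# | v₁ ≟ 0# | v₂ ≟ 0#
  ... | no v₀≢0 | _        | _        = scale (inv v₀ v₀≢0) (v₀ ∷ v₁ ∷ v₂ ∷ [])
  ... | yes _   | no v₁≢0 | _        = scale (inv v₁ v₁≢0) (v₀ ∷ v₁ ∷ v₂ ∷ [])
  ... | yes _   | yes _    | no v₂≢0 = scale (inv v₂ v₂≢0) (v₀ ∷ v₁ ∷ v₂ ∷ [])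
  ... | yes _   | yes _    | yes _    = 0# ∷ 0# ∷ 1# ∷ []

  Represents : Vec3 → Vec3 → Set
  Represents y v = y ∈ PG2 × Σ Carrier λ t → t ≢ 0# × y ≡ scale t v

  normalise-represents : ∀ v → NonZeroVec v → Represents (normalise v) v
  normalise-represents (v₀ ∷ v₁ ∷ v₂ ∷ []) v≢0 with v₀ ≟ 0# | v₁ ≟ 0# | v₂ ≟ 0#
  ... | no v₀≢0 | _ | _ =
    subst (_∈ PG2) (cong (λ s → s ∷ inv v₀ v₀≢0 * v₁ ∷ inv v₀ v₀≢0 * v₂ ∷ []) (sym (inv-l v₀ v₀≢0))) ([1,a,b]∈PG2 _ _) ,
    inv v₀ v₀≢0 , inv≢0 v₀ v₀≢0 , refl
  ... | yes v₀≡0 | no v₁≢0 | _ =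
    subst (_∈ PG2) (cong₂ (λ s t → s ∷ t ∷ inv v₁ v₁≢0 * v₂ ∷ []) (sym (scaled-zero v₀≡0)) (sym (inv-l v₁ v₁≢0)))
      ([0,1,a]∈PG2 _) ,
    inv v₁ v₁≢0 , inv≢0 v₁ v₁≢0 , refl
  ... | yes v₀≡0 | yes v₁≡0 | no v₂≢0 =
    subst (_∈ PG2) (vec3-cong (sym (scaled-zero v₀≡0)) (sym (scaled-zero v₁≡0)) (sym (inv-l v₂ v₂≢0))) [0,0,1]∈PG2 ,
    inv v₂ v₂≢0 , inv≢0 v₂ v₂≢0 , refl
  ... | yes v₀≡0 | yes v₁≡0 | yes v₂≡0 = ⊥-elim (v≢0 (vec3-cong v₀≡0 v₁≡0 v₂≡0))

  cross-scaleˡ : ∀ t (x y : Vec3) i → coord (cross (scale t x) y) i ≡ t * coord (cross x y) i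
  cross-scaleˡ t (x₀ ∷ x₁ ∷ x₂ ∷ []) (y₀ ∷ y₁ ∷ y₂ ∷ []) zero =
    solve 5 (λ t x₁ x₂ y₁ y₂ → (t :* x₁) :* y₂ :- (t :* x₂) :* y₁ := t :* (x₁ :* y₂ :- x₂ :* y₁)) refl t x₁ x₂ y₁ y₂
  cross-scaleˡ t (x₀ ∷ x₁ ∷ x₂ ∷ []) (y₀ ∷ y₁ ∷ y₂ ∷ []) (suc zero) =
    solve 5 (λ t x₀ x₂ y₀ y₂ → (t :* x₂) :* y₀ :- (t :* x₀) :* y₂ := t :* (x₂ :* y₀ :- x₀ :* y₂)) refl t x₀ x₂ y₀ y₂
  cross-scaleˡ t (x₀ ∷ x₁ ∷ x₂ ∷ []) (y₀ ∷ y₁ ∷ y₂ ∷ []) (suc (suc zero)) =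
    solve 5 (λ t x₀ x₁ y₀ y₁ → (t :* x₀) :* y₁ :- (t :* x₁) :* y₀ := t :* (x₀ :* y₁ :- x₁ :* y₀)) refl t x₀ x₁ y₀ y₁

  cross-parallel : ∀ t (y : Vec3) i → coord (cross (scale t y) y) i ≡ 0#
  cross-parallel t (y₀ ∷ y₁ ∷ y₂ ∷ []) zero =
    solve 3 (λ t y₁ y₂ → (t :* y₁) :* y₂ :- (t :* y₂) :* y₁ := κ0) refl t y₁ y₂
  cross-parallel t (y₀ ∷ y₁ ∷ y₂ ∷ []) (suc zero) =
    solve 3 (λ t y₀ y₂ → (t :* y₂) :* y₀ :- (t :* y₀) :* y₂ := κ0) refl t y₀ y₂
  cross-parallel t (y₀ ∷ y₁ ∷ y₂ ∷ []) (suc (suc zero)) =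
    solve 3 (λ t y₀ y₁ → (t :* y₀) :* y₁ :- (t :* y₁) :* y₀ := κ0) refl t y₀ y₁

  proportional⇒≡ : ∀ {x x′} → x ∈ PG2 → x′ ∈ PG2 → ∀ t t′ → t ≢ 0# → scale t x ≡ scale t′ x′ → x ≡ x′
  proportional⇒≡ {x} {x′} x∈ x′∈ t t′ t≢0 tx≡t′x′ = cross≡0⇒≡ (normalised x∈) (normalised x′∈) λ i →
    nonzero-factor _ t≢0 (begin
      t * coord (cross x x′) i         ≡⟨ sym (cross-scaleˡ t x x′ i) ⟩
      coord (cross (scale t x) x′) i   ≡⟨ cong (λ v → coord (cross v x′) i) tx≡t′x′ ⟩
      coord (cross (scale t′ x′) x′) i ≡⟨ cross-parallel t′ x′ i ⟩
      0#                               ∎)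

  ·-scale : ∀ t (r v : Vec3) → r · scale t v ≡ t * (r · v)
  ·-scale t (r₀ ∷ r₁ ∷ r₂ ∷ []) (v₀ ∷ v₁ ∷ v₂ ∷ []) =
    solve 7 (λ t r₀ r₁ r₂ v₀ v₁ v₂ → dot3 r₀ r₁ r₂ (t :* v₀) (t :* v₁) (t :* v₂) := t :* dot3 r₀ r₁ r₂ v₀ v₁ v₂)
      refl t r₀ r₁ r₂ v₀ v₁ v₂

  ⊛-scale : ∀ (A : Matrix3) t x → A ⊛ scale t x ≡ scale t (A ⊛ x)
  ⊛-scale (r₀ ∷ r₁ ∷ r₂ ∷ []) t x = vec3-cong (·-scale t r₀ x) (·-scale t r₁ x) (·-scale t r₂ x)

  ⊛-zero : ∀ (A : Matrix3) → A ⊛ Vec.replicate 3 0# ≡ Vec.replicate 3 0#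
  ⊛-zero (r₀ ∷ r₁ ∷ r₂ ∷ []) = vec3-cong (·-zero r₀) (·-zero r₁) (·-zero r₂)
    where
    ·-zero : ∀ (r : Vec3) → r · Vec.replicate 3 0# ≡ 0#
    ·-zero (r₀ ∷ r₁ ∷ r₂ ∷ []) = solve 3 (λ r₀ r₁ r₂ → dot3 r₀ r₁ r₂ κ0 κ0 κ0 := κ0) refl r₀ r₁ r₂

  -- the transpose action on covectors: (Aᵀ m) · x = m · (A x), so Aᵀ m is
  -- the preimage of the line m under x ↦ A x
  _ᵀ⊛_ : Matrix3 → Vec3 → Vec3
  ((a₀ ∷ a₁ ∷ a₂ ∷ []) ∷ (b₀ ∷ b₁ ∷ b₂ ∷ []) ∷ (c₀′ ∷ c₁ ∷ c₂ ∷ []) ∷ []) ᵀ⊛ (m₀ ∷ m₁ ∷ m₂ ∷ []) =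
    (m₀ * a₀ + m₁ * b₀ + m₂ * c₀′) ∷ (m₀ * a₁ + m₁ * b₁ + m₂ * c₁) ∷ (m₀ * a₂ + m₁ * b₂ + m₂ * c₂) ∷ []

  ᵀ⊛-· : ∀ (A : Matrix3) (m x : Vec3) → (A ᵀ⊛ m) · x ≡ m · (A ⊛ x)
  ᵀ⊛-· ((a₀ ∷ a₁ ∷ a₂ ∷ []) ∷ (b₀ ∷ b₁ ∷ b₂ ∷ []) ∷ (c₀′ ∷ c₁ ∷ c₂ ∷ []) ∷ []) (m₀ ∷ m₁ ∷ m₂ ∷ []) (x₀ ∷ x₁ ∷ x₂ ∷ []) =
    solve 15 (λ a₀ a₁ a₂ b₀ b₁ b₂ c₀′ c₁ c₂ m₀ m₁ m₂ x₀ x₁ x₂ →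
      dot3 (m₀ :* a₀ :+ m₁ :* b₀ :+ m₂ :* c₀′) (m₀ :* a₁ :+ m₁ :* b₁ :+ m₂ :* c₁) (m₀ :* a₂ :+ m₁ :* b₂ :+ m₂ :* c₂) x₀ x₁ x₂
        := dot3 m₀ m₁ m₂ (dot3 a₀ a₁ a₂ x₀ x₁ x₂) (dot3 b₀ b₁ b₂ x₀ x₁ x₂) (dot3 c₀′ c₁ c₂ x₀ x₁ x₂))
      refl a₀ a₁ a₂ b₀ b₁ b₂ c₀′ c₁ c₂ m₀ m₁ m₂ x₀ x₁ x₂

  module Collineation (A B : Matrix3) (B∘A≡id : ∀ x → B ⊛ (A ⊛ x) ≡ x) where

    image≢0 : ∀ {x} → x ∈ PG2 → NonZeroVec (A ⊛ x)
    image≢0 {x} x∈ Ax≡0 = point≢0 x∈ (trans (sym (B∘A≡id x)) (trans (cong (B ⊛_) Ax≡0) (⊛-zero B)))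

    σ : Vec3 → Vec3
    σ x = normalise (A ⊛ x)

    σ-represents : ∀ {x} → x ∈ PG2 → Represents (σ x) (A ⊛ x)
    σ-represents x∈ = normalise-represents _ (image≢0 x∈)

    σ∈PG2 : ∀ {x} → x ∈ PG2 → σ x ∈ PG2
    σ∈PG2 x∈ = proj₁ (σ-represents x∈)

    σ-injective : ∀ {x x′} → x ∈ PG2 → x′ ∈ PG2 → σ x ≡ σ x′ → x ≡ x′
    σ-injective {x} {x′} x∈ x′∈ σx≡σx′ with σ-represents x∈ | σ-represents x′∈
    ... | _ , t , t≢0 , σx≡tAx | _ , t′ , _ , σx′≡t′Ax′ = proportional⇒≡ x∈ x′∈ t t′ t≢0 (begin
      scale t x                   ≡⟨ sym (B∘A≡id (scale t x)) ⟩
      B ⊛ (A ⊛ scale t x)         ≡⟨ cong (B ⊛_) (⊛-scale A t x) ⟩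
      B ⊛ scale t (A ⊛ x)         ≡⟨ cong (B ⊛_) (trans (sym σx≡tAx) (trans σx≡σx′ σx′≡t′Ax′)) ⟩
      B ⊛ scale t′ (A ⊛ x′)       ≡⟨ cong (B ⊛_) (sym (⊛-scale A t′ x′)) ⟩
      B ⊛ (A ⊛ scale t′ x′)       ≡⟨ B∘A≡id (scale t′ x′) ⟩
      scale t′ x′                 ∎)

    on-preimage⇒on : ∀ m {x} → x ∈ PG2 → (A ᵀ⊛ m) · x ≡ 0# → m · σ x ≡ 0#
    on-preimage⇒on m {x} x∈ on-Aᵀm with σ-represents x∈
    ... | _ , t , _ , σx≡tAx = begin
      m · σ x              ≡⟨ cong (m ·_) σx≡tAx ⟩
      m · scale t (A ⊛ x)  ≡⟨ ·-scale t m (A ⊛ x) ⟩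
      t * (m · (A ⊛ x))    ≡⟨ cong (t *_) (sym (ᵀ⊛-· A m x)) ⟩
      t * ((A ᵀ⊛ m) · x)   ≡⟨ scaled-zero on-Aᵀm ⟩
      0#                   ∎

    on⇒on-preimage : ∀ m {x} → x ∈ PG2 → m · σ x ≡ 0# → (A ᵀ⊛ m) · x ≡ 0#
    on⇒on-preimage m {x} x∈ on-m with σ-represents x∈
    ... | _ , t , t≢0 , σx≡tAx = trans (ᵀ⊛-· A m x) (nonzero-factor _ t≢0
      (trans (sym (·-scale t m (A ⊛ x))) (trans (cong (m ·_) (sym σx≡tAx)) on-m)))

  c₀-[0,1,a] : ∀ a → c₀ (0# ∷ 1# ∷ a ∷ []) ≡ a
  c₀-[0,1,a] a with 0# ≟ 0# | 0# ≟ 1# | 1# ≟ 0# | 1# ≟ 1#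
  ... | yes _   | _ | _ | yes _   = refl
  ... | no 0≢0 | _ | _ | _       = ⊥-elim (0≢0 refl)
  ... | yes _   | _ | _ | no 1≢1 = ⊥-elim (1≢1 refl)

  c₀-[1,0,b] : ∀ b → c₀ (1# ∷ 0# ∷ b ∷ []) ≡ b
  c₀-[1,0,b] b with 1# ≟ 0# | 1# ≟ 1# | 0# ≟ 0# | 0# ≟ 1#
  ... | yes 1≡0 | _       | _       | _ = ⊥-elim (1≢0 1≡0)
  ... | no _    | no 1≢1 | _       | _ = ⊥-elim (1≢1 refl)
  ... | no _    | yes _   | no 0≢0 | _ = ⊥-elim (0≢0 refl)
  ... | no _    | yes _   | yes _   | _ = refl

  c₀-[1,1,e] : ∀ e → c₀ (1# ∷ 1# ∷ e ∷ []) ≡ - e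
  c₀-[1,1,e] e with 1# ≟ 0# | 1# ≟ 1#
  ... | yes 1≡0 | _       = ⊥-elim (1≢0 1≡0)
  ... | no _    | no 1≢1 = ⊥-elim (1≢1 refl)
  ... | no _    | yes _   = refl

  c₀-elsewhere : ∀ a b → a ≢ 0# → a ≢ 1# → c₀ (1# ∷ a ∷ b ∷ []) ≡ 0#
  c₀-elsewhere a b a≢0 a≢1 with 1# ≟ 0# | 1# ≟ 1# | a ≟ 0# | a ≟ 1#
  ... | yes 1≡0 | _     | _       | _       = ⊥-elim (1≢0 1≡0)
  ... | no _    | _     | yes a≡0 | _       = ⊥-elim (a≢0 a≡0)
  ... | no _    | _     | no _    | yes a≡1 = ⊥-elim (a≢1 a≡1)
  ... | no _    | yes _ | no _    | no _    = refl
  ... | no _    | no _  | no _    | no _    = refl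

  m·[x₀,x₁,x₂] : ∀ x₀ x₁ x₂ → m-line · (x₀ ∷ x₁ ∷ x₂ ∷ []) ≡ x₀
  m·[x₀,x₁,x₂] = solve 3 (λ x₀ x₁ x₂ → dot3 κ1 κ0 κ0 x₀ x₁ x₂ := x₀) refl

  m′·[x₀,x₁,x₂] : ∀ x₀ x₁ x₂ → m′-line · (x₀ ∷ x₁ ∷ x₂ ∷ []) ≡ x₁
  m′·[x₀,x₁,x₂] = solve 3 (λ x₀ x₁ x₂ → dot3 κ0 κ1 κ0 x₀ x₁ x₂ := x₁) refl

  m″·[x₀,x₁,x₂] : ∀ x₀ x₁ x₂ → m″-line · (x₀ ∷ x₁ ∷ x₂ ∷ []) ≡ x₀ - x₁
  m″·[x₀,x₁,x₂] = solve 3 (λ x₀ x₁ x₂ → dot3 κ1 (:- κ1) κ0 x₀ x₁ x₂ := x₀ :- x₁) refl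

  indicator-on : ∀ b y → b · y ≡ 0# → indicator b y ≡ 1#
  indicator-on b y on-b with (b · y) ≟ 0#
  ... | yes _     = refl
  ... | no off-b = ⊥-elim (off-b on-b)

  indicator-off : ∀ b y → b · y ≢ 0# → indicator b y ≡ 0#
  indicator-off b y off-b with (b · y) ≟ 0#
  ... | yes on-b = ⊥-elim (off-b on-b)
  ... | no _     = refl

  centre : Vec3
  centre = 0# ∷ 0# ∷ 1# ∷ []

  OneZeroOffCentre : (Vec3 → Carrier) → Vec3 → Set
  OneZeroOffCentre g m = ∀ y y′ → y ∈ PG2 → y′ ∈ PG2 → m · y ≡ 0# → m · y′ ≡ 0# →
    y ≢ centre → y′ ≢ centre → g y ≡ 0# → g y′ ≡ 0# → y ≡ y′

  affine⇒one-zero : ∀ g m (param : Carrier → Vec3) slope κ → slope ≢ 0# → (∀ t → g (param t) ≡ slope * t + κ) →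
    (∀ y → y ∈ PG2 → m · y ≡ 0# → y ≢ centre → ∃ λ t → y ≡ param t) → OneZeroOffCentre g m
  affine⇒one-zero g m param slope κ slope≢0 affine parametrised y y′ y∈ y′∈ on-m on-m′ y≢c y′≢c gy≡0 gy′≡0
    with parametrised y y∈ on-m y≢c | parametrised y′ y′∈ on-m′ y′≢c
  ... | t , refl | t′ , refl = cong param (cancelˡ t t′ slope≢0 (begin
    slope * t            ≡⟨ solve 3 (λ s t k → s :* t := (s :* t :+ k) :- k) refl slope t κ ⟩
    (slope * t + κ) - κ  ≡⟨ cong (_- κ) (trans (sym (affine t)) (trans gy≡0 (trans (sym gy′≡0) (affine t′)))) ⟩
    (slope * t′ + κ) - κ ≡⟨ solve 3 (λ s t k → (s :* t :+ k) :- k := s :* t) refl slope t′ κ ⟩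
    slope * t′           ∎))

  0-1≡-1 : 0# - 1# ≡ - 1#
  0-1≡-1 = +-identityˡ (- 1#)

  1-0≡1 : 1# - 0# ≡ 1#
  1-0≡1 = solve 0 (κ1 :- κ0 := κ1) refl

  1-1≡0 : 1# - 1# ≡ 0#
  1-1≡0 = -‿inverseʳ 1#

  module OddWord (γ w₁ w₂ w₃ : ℕ) (γ≢0 : γ ×1 ≢ 0#) where

    g : Vec3 → Carrier
    g = oddWord γ w₁ w₂ w₃

    g-at : ∀ y {c i₁ i₂ i₃} → c₀ y ≡ c → indicator m-line y ≡ i₁ → indicator m′-line y ≡ i₂ →
      indicator m″-line y ≡ i₃ → g y ≡ γ ×1 * c + w₁ ×1 * i₁ + w₂ ×1 * i₂ + w₃ ×1 * i₃
    g-at y refl refl refl refl = refl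

    g-on-m : ∀ a → g (0# ∷ 1# ∷ a ∷ []) ≡ γ ×1 * a + w₁ ×1
    g-on-m a = trans
      (g-at _ (c₀-[0,1,a] a) (indicator-on m-line _ (m·[x₀,x₁,x₂] _ _ _))
            (indicator-off m′-line _ (λ on → 1≢0 (trans (sym (m′·[x₀,x₁,x₂] _ _ _)) on)))
            (indicator-off m″-line _ (λ on → -1≢0 (trans (sym 0-1≡-1) (trans (sym (m″·[x₀,x₁,x₂] _ _ _)) on)))))
      (solve 5 (λ γ a u v w → γ :* a :+ u :* κ1 :+ v :* κ0 :+ w :* κ0 := γ :* a :+ u) refl _ _ _ _ _)

    g-on-m′ : ∀ b → g (1# ∷ 0# ∷ b ∷ []) ≡ γ ×1 * b + w₂ ×1
    g-on-m′ b = trans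
      (g-at _ (c₀-[1,0,b] b) (indicator-off m-line _ (λ on → 1≢0 (trans (sym (m·[x₀,x₁,x₂] _ _ _)) on)))
            (indicator-on m′-line _ (m′·[x₀,x₁,x₂] _ _ _))
            (indicator-off m″-line _ (λ on → 1≢0 (trans (sym 1-0≡1) (trans (sym (m″·[x₀,x₁,x₂] _ _ _)) on)))))
      (solve 5 (λ γ b u v w → γ :* b :+ u :* κ0 :+ v :* κ1 :+ w :* κ0 := γ :* b :+ v) refl _ _ _ _ _)

    g-on-m″ : ∀ e → g (1# ∷ 1# ∷ e ∷ []) ≡ - (γ ×1) * e + w₃ ×1
    g-on-m″ e = trans
      (g-at _ (c₀-[1,1,e] e) (indicator-off m-line _ (λ on → 1≢0 (trans (sym (m·[x₀,x₁,x₂] _ _ _)) on)))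
            (indicator-off m′-line _ (λ on → 1≢0 (trans (sym (m′·[x₀,x₁,x₂] _ _ _)) on)))
            (indicator-on m″-line _ (trans (m″·[x₀,x₁,x₂] _ _ _) 1-1≡0)))
      (solve 5 (λ γ e u v w → γ :* (:- e) :+ u :* κ0 :+ v :* κ0 :+ w :* κ1 := (:- γ) :* e :+ w) refl _ _ _ _ _)

    g-support : ∀ y → y ∈ PG2 → g y ≢ 0# → m-line · y ≡ 0# ⊎ m′-line · y ≡ 0# ⊎ m″-line · y ≡ 0#
    g-support y y∈ gy≢0 with (m-line · y) ≟ 0# | (m′-line · y) ≟ 0# | (m″-line · y) ≟ 0#
    ... | yes on-m | _         | _          = inj₁ on-m
    ... | no _     | yes on-m′ | _          = inj₂ (inj₁ on-m′)
    ... | no _     | no _      | yes on-m″ = inj₂ (inj₂ on-m″)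
    ... | no off-m | no off-m′ | no off-m″ with normalised y∈
    ...   | [0,1,a] _ = ⊥-elim (off-m (m·[x₀,x₁,x₂] _ _ _))
    ...   | [0,0,1]   = ⊥-elim (off-m (m·[x₀,x₁,x₂] _ _ _))
    ...   | [1,a,b] a b = ⊥-elim (gy≢0 (trans
            (cong (λ c → γ ×1 * c + w₁ ×1 * 0# + w₂ ×1 * 0# + w₃ ×1 * 0#)
                  (c₀-elsewhere a b (λ a≡0 → off-m′ (trans (m′·[x₀,x₁,x₂] _ _ _) a≡0))
                     (λ a≡1 → off-m″ (trans (m″·[x₀,x₁,x₂] _ _ _) (trans (cong (λ t → 1# - t) a≡1) 1-1≡0)))))
            (solve 4 (λ γ u v w → γ :* κ0 :+ u :* κ0 :+ v :* κ0 :+ w :* κ0 := κ0) refl _ _ _ _)))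

    one-zero-m : OneZeroOffCentre g m-line
    one-zero-m = affine⇒one-zero g m-line (λ a → 0# ∷ 1# ∷ a ∷ []) (γ ×1) (w₁ ×1) γ≢0 g-on-m parametrised
      where
      parametrised : ∀ y → y ∈ PG2 → m-line · y ≡ 0# → y ≢ centre → ∃ λ t → y ≡ 0# ∷ 1# ∷ t ∷ []
      parametrised y y∈ on-m y≢c with normalised y∈
      ... | [1,a,b] _ _ = ⊥-elim (1≢0 (trans (sym (m·[x₀,x₁,x₂] _ _ _)) on-m))
      ... | [0,1,a] a   = a , refl
      ... | [0,0,1]     = ⊥-elim (y≢c refl)

    one-zero-m′ : OneZeroOffCentre g m′-line
    one-zero-m′ = affine⇒one-zero g m′-line (λ b → 1# ∷ 0# ∷ b ∷ []) (γ ×1) (w₂ ×1) γ≢0 g-on-m′ parametrised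
      where
      parametrised : ∀ y → y ∈ PG2 → m′-line · y ≡ 0# → y ≢ centre → ∃ λ t → y ≡ 1# ∷ 0# ∷ t ∷ []
      parametrised y y∈ on-m′ y≢c with normalised y∈
      ... | [1,a,b] a b with trans (sym (m′·[x₀,x₁,x₂] 1# a b)) on-m′
      ...   | refl = b , refl
      parametrised y y∈ on-m′ y≢c | [0,1,a] _ = ⊥-elim (1≢0 (trans (sym (m′·[x₀,x₁,x₂] _ _ _)) on-m′))
      parametrised y y∈ on-m′ y≢c | [0,0,1]   = ⊥-elim (y≢c refl)

    one-zero-m″ : OneZeroOffCentre g m″-line
    one-zero-m″ = affine⇒one-zero g m″-line (λ e → 1# ∷ 1# ∷ e ∷ []) (- (γ ×1)) (w₃ ×1) (-≢0 γ≢0) g-on-m″ parametrised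
      where
      parametrised : ∀ y → y ∈ PG2 → m″-line · y ≡ 0# → y ≢ centre → ∃ λ t → y ≡ 1# ∷ 1# ∷ t ∷ []
      parametrised y y∈ on-m″ y≢c with normalised y∈
      ... | [1,a,b] a b with difference-zero 1# a (trans (sym (m″·[x₀,x₁,x₂] 1# a b)) on-m″)
      ...   | refl = b , refl
      parametrised y y∈ on-m″ y≢c | [0,1,a] _ =
        ⊥-elim (-1≢0 (trans (sym 0-1≡-1) (trans (sym (m″·[x₀,x₁,x₂] _ _ _)) on-m″)))
      parametrised y y∈ on-m″ y≢c | [0,0,1]   = ⊥-elim (y≢c refl)

  -- Planes of type T^odd: f = g ∘ σ on points, for the collineation σ given
  -- by an invertible matrix A.  For a line b, either b is the preimage of one
  -- of m, m′, m″ (then f has at most two zeros on b: the preimage of the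
  -- centre and one more), or b meets each of these three preimages in at
  -- most one point, and supp f lies in their union.
  module OddSecancy (γ w₁ w₂ w₃ : ℕ) (γ≢0 : γ ×1 ≢ 0#) (A B : Matrix3) (B∘A≡id : ∀ x → B ⊛ (A ⊛ x) ≡ x)
    (f : Vec3 → Carrier)
    (f≡g : ∀ x y → x ∈ PG2 → y ∈ PG2 → Proportional y (A ⊛ x) → f x ≡ oddWord γ w₁ w₂ w₃ y)
    (b : Vec3) (b≢0 : NonZeroVec b) where

    open OddWord γ w₁ w₂ w₃ γ≢0
    open Collineation A B B∘A≡id

    f≡g∘σ : ∀ {x} → x ∈ PG2 → f x ≡ g (σ x)
    f≡g∘σ {x} x∈ with σ-represents x∈
    ... | σx∈ , t , _ , σx≡tAx = f≡g x (σ x) x∈ σx∈ (t , σx≡tAx)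

    is-centre : Vec3 → Bool
    is-centre v = ⌊ ≡-dec _≟_ v centre ⌋

    is-centre-true : ∀ v → is-centre v ≡ true → v ≡ centre
    is-centre-true v eq with ≡-dec _≟_ v centre
    ... | yes v≡c = v≡c

    is-centre-false : ∀ v → is-centre v ≡ false → v ≢ centre
    is-centre-false v eq with ≡-dec _≟_ v centre
    ... | no v≢c = v≢c

    preimage-case : ∀ m → OneZeroOffCentre g m → b ⊆ᴸ (A ᵀ⊛ m) → order ∸ 1 ≤ secancy f (b , b≢0)
    preimage-case m one-zero b⊆Aᵀm = ℕP.∸-monoˡ-≤ 1 (ℕP.≤-pred (ℕP.≤-trans
      (few-zeros⇒long f (b , b≢0) 2 (ℕP.≤-trans (count-cover _ _ _ PG2 centre-or-not) (ℕP.+-mono-≤ centre-once zero-once)))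
      (ℕP.≤-reflexive (ℕP.+-comm _ 2))))
      where
      centre-or-not : ∀ x → x ∈ PG2 → on b x ∧ isZero (f x) ≡ true →
        on b x ∧ is-centre (σ x) ≡ true ⊎ on b x ∧ (isZero (f x) ∧ not (is-centre (σ x))) ≡ true
      centre-or-not x _ zero-on-b with on b x | isZero (f x) | is-centre (σ x)
      ... | true | true | true  = inj₁ refl
      ... | true | true | false = inj₂ refl
      centre-once : count (λ x → on b x ∧ is-centre (σ x)) PG2 ≤ 1
      centre-once = count-≤1 _ PG2 PG2-unique λ x x′ x∈ x′∈ cx cx′ → σ-injective x∈ x′∈
        (trans (is-centre-true (σ x) (∧-elimʳ cx)) (sym (is-centre-true (σ x′) (∧-elimʳ cx′))))
      zero-once : count (λ x → on b x ∧ (isZero (f x) ∧ not (is-centre (σ x)))) PG2 ≤ 1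
      zero-once = count-≤1 _ PG2 PG2-unique λ x x′ x∈ x′∈ zx zx′ → σ-injective x∈ x′∈
        (one-zero (σ x) (σ x′) (σ∈PG2 x∈) (σ∈PG2 x′∈) (on-m x∈ zx) (on-m x′∈ zx′)
          (off-centre x zx) (off-centre x′ zx′) (is-zero x∈ zx) (is-zero x′∈ zx′))
        where
        on-m : ∀ {x} → x ∈ PG2 → on b x ∧ (isZero (f x) ∧ not (is-centre (σ x))) ≡ true → m · σ x ≡ 0#
        on-m x∈ zx = on-preimage⇒on m x∈ (isZero⇒≡0 _ (b⊆Aᵀm _ x∈ (∧-elimˡ zx)))
        off-centre : ∀ x → on b x ∧ (isZero (f x) ∧ not (is-centre (σ x))) ≡ true → σ x ≢ centre
        off-centre x zx with is-centre (σ x) in c | ∧-elimʳ {isZero (f x)} (∧-elimʳ {on b x} zx)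
        ... | false | _  = is-centre-false (σ x) c
        ... | true  | ()
        is-zero : ∀ {x} → x ∈ PG2 → on b x ∧ (isZero (f x) ∧ not (is-centre (σ x))) ≡ true → g (σ x) ≡ 0#
        is-zero {x} x∈ zx = trans (sym (f≡g∘σ x∈)) (isZero⇒≡0 _ (∧-elimˡ (∧-elimʳ {on b x} zx)))

    general-case : ∀ {m m′ m″} → count (λ x → on b x ∧ on (A ᵀ⊛ m) x) PG2 ≤ 1 →
      count (λ x → on b x ∧ on (A ᵀ⊛ m′) x) PG2 ≤ 1 → count (λ x → on b x ∧ on (A ᵀ⊛ m″) x) PG2 ≤ 1 →
      (∀ x → x ∈ PG2 → f x ≢ 0# → on (A ᵀ⊛ m) x ≡ true ⊎ on (A ᵀ⊛ m′) x ≡ true ⊎ on (A ᵀ⊛ m″) x ≡ true) →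
      secancy f (b , b≢0) ≤ 3
    general-case {m} {m′} {m″} meet meet′ meet″ support =
      ℕP.≤-trans (count-cover _ _ _ PG2 first-or-rest)
     (ℕP.≤-trans (ℕP.+-monoʳ-≤ _ (count-cover _ _ _ PG2 second-or-third))
                 (ℕP.+-mono-≤ meet (ℕP.+-mono-≤ meet′ meet″)))
      where
      first-or-rest : ∀ x → x ∈ PG2 → on b x ∧ not (isZero (f x)) ≡ true →
        on b x ∧ on (A ᵀ⊛ m) x ≡ true ⊎ on b x ∧ (on (A ᵀ⊛ m′) x Bool.∨ on (A ᵀ⊛ m″) x) ≡ true
      first-or-rest x x∈ in-support with support x x∈ (not-isZero⇒≢0 _ (∧-elimʳ {on b x} in-support))
      ... | inj₁ on-m         = inj₁ (∧-intro on-b on-m)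
        where on-b = ∧-elimˡ {on b x} in-support
      ... | inj₂ (inj₁ on-m′) = inj₂ (∧-intro on-b (cong (Bool._∨ on (A ᵀ⊛ m″) x) on-m′))
        where on-b = ∧-elimˡ {on b x} in-support
      ... | inj₂ (inj₂ on-m″) = inj₂ (∧-intro on-b (trans (cong (on (A ᵀ⊛ m′) x Bool.∨_) on-m″) (∨-true _)))
        where
        on-b = ∧-elimˡ {on b x} in-support
        ∨-true : ∀ a → a Bool.∨ true ≡ true
        ∨-true true  = refl
        ∨-true false = refl
      second-or-third : ∀ x → x ∈ PG2 → on b x ∧ (on (A ᵀ⊛ m′) x Bool.∨ on (A ᵀ⊛ m″) x) ≡ true →
        on b x ∧ on (A ᵀ⊛ m′) x ≡ true ⊎ on b x ∧ on (A ᵀ⊛ m″) x ≡ true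
      second-or-third x _ in-rest with on b x | on (A ᵀ⊛ m′) x
      ... | true | true  = inj₁ refl
      ... | true | false = inj₂ in-rest

    f-support : ∀ x → x ∈ PG2 → f x ≢ 0# →
      on (A ᵀ⊛ m-line) x ≡ true ⊎ on (A ᵀ⊛ m′-line) x ≡ true ⊎ on (A ᵀ⊛ m″-line) x ≡ true
    f-support x x∈ fx≢0 with g-support (σ x) (σ∈PG2 x∈) (λ gσx≡0 → fx≢0 (trans (f≡g∘σ x∈) gσx≡0))
    ... | inj₁ on-m         = inj₁ (≡0⇒isZero _ (on⇒on-preimage m-line x∈ on-m))
    ... | inj₂ (inj₁ on-m′) = inj₂ (inj₁ (≡0⇒isZero _ (on⇒on-preimage m′-line x∈ on-m′)))
    ... | inj₂ (inj₂ on-m″) = inj₂ (inj₂ (≡0⇒isZero _ (on⇒on-preimage m″-line x∈ on-m″)))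

    secancy-bound : secancy f (b , b≢0) ≤ 3 ⊎ order ∸ 1 ≤ secancy f (b , b≢0)
    secancy-bound with two-lines b (A ᵀ⊛ m-line) b≢0 | two-lines b (A ᵀ⊛ m′-line) b≢0 | two-lines b (A ᵀ⊛ m″-line) b≢0
    ... | inj₁ b⊆ | _        | _        = inj₂ (preimage-case m-line one-zero-m b⊆)
    ... | inj₂ _  | inj₁ b⊆ | _        = inj₂ (preimage-case m′-line one-zero-m′ b⊆)
    ... | inj₂ _  | inj₂ _   | inj₁ b⊆ = inj₂ (preimage-case m″-line one-zero-m″ b⊆)
    ... | inj₂ meet | inj₂ meet′ | inj₂ meet″ = inj₁ (general-case meet meet′ meet″ f-support)

  type-odd-secancy : ∀ p h f → TypeOdd p h f → (ℓ : Line2) → secancy f ℓ ≤ 3 ⊎ order ∸ 1 ≤ secancy f ℓ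
  type-odd-secancy p h f (_ , _ , γ , w₁ , w₂ , w₃ , A , B , γ≢0 , B∘A≡id , f≡g) (b , b≢0) =
    OddSecancy.secancy-bound γ w₁ w₂ w₃ γ≢0 A B B∘A≡id f f≡g b b≢0

  type-𝒯-secancy : ∀ p h f → TypeCalT p h f → (ℓ : Line2) → secancy f ℓ ≤ 3 ⊎ order ∸ 1 ≤ secancy f ℓ
  type-𝒯-secancy p h f (inj₁ tw) ℓ with type-Tw-secancy f tw ℓ
  ... | inj₁ short = inj₁ (ℕP.m≤n⇒m≤1+n short)
  ... | inj₂ long  = inj₂ (ℕP.≤-trans (ℕP.m∸n≤m order 1) long)
  type-𝒯-secancy p h f (inj₂ (inj₁ odd)) = type-odd-secancy p h f odd
  type-𝒯-secancy p h f (inj₂ (inj₂ (inj₁ (ℓ₁ , ℓ₂ , ℓ₃ , _ , comb)))) = three-lines-secancy f ℓ₁ ℓ₂ ℓ₃ comb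
  type-𝒯-secancy p h f (inj₂ (inj₂ (inj₂ (ℓ₁ , ℓ₂ , ℓ₃ , _ , comb)))) = three-lines-secancy f ℓ₁ ℓ₂ ℓ₃ comb

open Defs

proposition3p2 : (F : FiniteField) (p h : ℕ) → Prime p → 1 ≤ h → order F ≡ p ^ h →
    (n : ℕ) → 2 ≤ n → (c : Codeword F n) → (π : Plane F n) →
    TypeCalT F p h (restrict F c π) →
      ((ℓ : Line2 F) → secancy F (restrict F c π) ℓ ≤ 3 ⊎ order F ∸ 1 ≤ secancy F (restrict F c π) ℓ)
      × (TypeTw F (restrict F c π) →
         (ℓ : Line2 F) → secancy F (restrict F c π) ℓ ≤ 2 ⊎ order F ≤ secancy F (restrict F c π) ℓ)
proposition3p2 F p h _ _ _ _ _ c π type-𝒯 =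
  PlaneGeometry.type-𝒯-secancy F p h (restrict F c π) type-𝒯 ,
  PlaneGeometry.type-Tw-secancy F (restrict F c π)
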